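{- Let $n,m \ge 1$, let $\omega=e^{2\pi i/m}$, and let $\mathcal H^m_{2n-1}$ be the complex hyperplane arrangement in $\mathbb C^{2n}$ (coordinates $x_1,\dots,x_n,y_1,\dots,y_n$) $$\mathcal H^m_{2n-1} = \{x_i - \omega^{\ell}x_j = y_i : 1\leq i < j \leq n,\ 0\leq \ell < m\} \cup \{x_i = y_i : 1\le i \le n\}.$$ Then the intersection lattice $\mathcal L(\mathcal H^m_{2n-1})$ is isomorphic to the induced subposet $\mathcal L_{2n-1}^m$ of the Dowling lattice $Q_{2n-1}(\mathbb Z_m)$ consisting of all labeled partitions $B_0|B_1|\cdots|B_k$ such that: if $B_0\ne\{0\}$ then $\min(B_0\setminus\{0\})$ is odd; and for every nonsingleton $B_i$ with $i>0$, $\min(B_i)$ is odd and $\max(B_i)$ is even.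
   Context: $\mathcal L(\mathcal A)$ is the intersection lattice of an arrangement (nonempty intersections of hyperplanes ordered by reverse inclusion). The Dowling lattice $Q_N(\mathbb Z_m)$ consists of labeled partitions $B_0|B_1|\cdots|B_k$ of $\{0\}\cup[N]$ such that $0\in B_0$ (the zero block, whose elements are unlabeled) and the elements of each $B_i$, $i\ge1$, are labeled by elements of $\{0,1,\dots,m-1\}$ with $\min(B_i)$ labeled $0$. The partial order is generated by the following cover relations (merging two blocks): merging $B_0$ with $B_i$ erases the labels of $B_i$ and forms the new zero block $B_0\cup B_i$; for $i,j\ne0$ with $\min(B_i)<\min(B_j)$, there are $m$ ways to merge $B_i$ and $B_j$: for each $\ell\in\{0,\dots,m-1\}$ the labels of $B_i$ are kept and $\ell$ is added modulo $m$ to each label of $B_j$, and the union is formed. -}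

module Defs where

open import Level using (Level; _⊔_; suc)
open import Algebra.Bundles using (CommutativeRing)
open import Data.Nat as ℕ using (ℕ; zero; NonZero; _%_)
open import Data.Nat.DivMod using (_mod_)
open import Data.Fin as Fin using (Fin; toℕ)
open import Data.Maybe using (Maybe; just; nothing)
open import Data.Product using (Σ; ∃; _×_; _,_)
open import Data.List using (List)
open import Data.List.Membership.Propositional using (_∈_)
open import Data.Vec using (Vec; lookup; tabulate)
open import Relation.Nullary using (¬_)
open import Relation.Binary.PropositionalEquality using (_≡_; _≢_)
open import Relation.Binary.Construct.Closure.ReflexiveTransitive using (Star)
open import Function.Bundles using (_⇔_)

-- Fields (stdlib has no Field bundle): a commutative ring with 1 ≉ 0
-- in which every nonzero element has a multiplicative inverse.

module _ {c ℓ : Level} (F : CommutativeRing c ℓ) where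
  open CommutativeRing F

  pow : Carrier → ℕ → Carrier
  pow x zero      = 1#
  pow x (ℕ.suc k) = x * pow x k

  natF : ℕ → Carrier
  natF zero      = 0#
  natF (ℕ.suc k) = 1# + natF k

  record IsField : Set (c ⊔ ℓ) where
    field
      nontrivial : ¬ (1# ≈ 0#)
      inverse    : ∀ x → ¬ (x ≈ 0#) → ∃ λ y → x * y ≈ 1#

  CharZero : Set ℓ
  CharZero = ∀ k → ¬ (natF (ℕ.suc k) ≈ 0#)

  PrimitiveRoot : (m : ℕ) → Carrier → Set ℓ
  PrimitiveRoot m ω = (pow ω m ≈ 1#) × (∀ k → 0 ℕ.< k → k ℕ.< m → ¬ (pow ω k ≈ 1#))

-- The arrangement H^m_{2n-1} in F^{2n}, coordinates x_1..x_n, y_1..y_n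
-- (indices 1..n are represented by Fin n).

data Hyp (n m : ℕ) : Set where
  hypDiff : (i j : Fin n) → i Fin.< j → (l : Fin m) → Hyp n m
  hypDiag : (i : Fin n) → Hyp n m

module _ {c ℓ : Level} (F : CommutativeRing c ℓ) (ω : CommutativeRing.Carrier F) where
  open CommutativeRing F

  Point : ℕ → Set c
  Point n = (Fin n → Carrier) × (Fin n → Carrier)

  _∈H_ : {n m : ℕ} → Point n → Hyp n m → Set ℓ
  (x , y) ∈H hypDiff i j _ l = x i - pow F ω (toℕ l) * x j ≈ y i
  (x , y) ∈H hypDiag i       = x i ≈ y i

  _∈⋂_ : {n m : ℕ} → Point n → List (Hyp n m) → Set (ℓ)
  p ∈⋂ S = ∀ {h} → h ∈ S → p ∈H h

  -- reverse inclusion of flats: X ≤ Y iff Y ⊆ X  (order of L(A))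
  _≤L_ : {n m : ℕ} → List (Hyp n m) → List (Hyp n m) → Set (c ⊔ ℓ)
  _≤L_ {n} S T = ∀ (p : Point n) → p ∈⋂ T → p ∈⋂ S

  -- every flat of the arrangement is an intersection ⋂ S; two subsets
  -- S, T give the same flat iff S ≤L T and T ≤L S.

-- An element 1..N of {0}∪[N] is represented by i : Fin N (value toℕ i + 1).
-- A labeled partition is encoded canonically by  f : Vec (Maybe (Fin N × Fin m)) N :
--   f i = nothing      iff  i ∈ B_0 (zero block),
--   f i = just (r , a) iff  i lies in the nonzero block with minimum r
--                           and i carries label a.

Raw : ℕ → ℕ → Set
Raw N m = Vec (Maybe (Fin N × Fin m)) N

zeroₘ : {m : ℕ} .{{_ : NonZero m}} → Fin m
zeroₘ {m} = 0 mod m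

_+ₘ_ : {m : ℕ} .{{_ : NonZero m}} → Fin m → Fin m → Fin m
_+ₘ_ {m} a b = (toℕ a ℕ.+ toℕ b) mod m

Valid : {N m : ℕ} .{{_ : NonZero m}} → Raw N m → Set
Valid {N} {m} f = ∀ (i r : Fin N) (a : Fin m) →
  lookup f i ≡ just (r , a) → (r Fin.≤ i) × (lookup f r ≡ just (r , zeroₘ))

IsBlockMin : {N m : ℕ} .{{_ : NonZero m}} → Raw N m → Fin N → Set
IsBlockMin f r = lookup f r ≡ just (r , zeroₘ)

mergeZero : {N m : ℕ} → Raw N m → Fin N → Raw N m
mergeZero {N} f r = tabulate g
  where
  g : Fin N → _
  g i with lookup f i
  ... | nothing = nothing
  ... | just (s , a) with r Fin.≟ s
  ...   | Relation.Nullary.yes _ = nothing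
  ...   | Relation.Nullary.no  _ = just (s , a)

mergeBlocks : {N m : ℕ} .{{_ : NonZero m}} → Raw N m → Fin N → Fin N → Fin m → Raw N m
mergeBlocks {N} {m} f r s l = tabulate g
  where
  g : Fin N → Maybe (Fin N × Fin m)
  g i with lookup f i
  ... | nothing = nothing
  ... | just (t , a) with s Fin.≟ t
  ...   | Relation.Nullary.yes _ = just (r , a +ₘ l)
  ...   | Relation.Nullary.no  _ = just (t , a)

data Cover {N m : ℕ} .{{_ : NonZero m}} : Raw N m → Raw N m → Set where
  coverZero   : ∀ f r → IsBlockMin f r → Cover f (mergeZero f r)
  coverBlocks : ∀ f r s l → IsBlockMin f r → IsBlockMin f s → r Fin.< s →
                Cover f (mergeBlocks f r s l)

_≤D_ : {N m : ℕ} .{{_ : NonZero m}} → Raw N m → Raw N m → Set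
_≤D_ = Star Cover

-- Parity of the actual element value toℕ i + 1 ∈ [N]
OddElt : {N : ℕ} → Fin N → Set
OddElt i = (ℕ.suc (toℕ i)) % 2 ≡ 1

EvenElt : {N : ℕ} → Fin N → Set
EvenElt i = (ℕ.suc (toℕ i)) % 2 ≡ 0

InBlock : {N m : ℕ} → Raw N m → Fin N → Fin N → Set
InBlock f r i = ∃ λ a → lookup f i ≡ just (r , a)

InL : {N m : ℕ} .{{_ : NonZero m}} → Raw N m → Set
InL {N} f =
  (∀ (i : Fin N) → lookup f i ≡ nothing →
     (∀ (j : Fin N) → j Fin.< i → lookup f j ≢ nothing) → OddElt i)
  ×
  (∀ (r : Fin N) → IsBlockMin f r → (∃ λ i → InBlock f r i × i ≢ r) →
     OddElt r × (∀ i → InBlock f r i → (∀ j → InBlock f r j → j Fin.≤ i) → EvenElt i))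

LDow : (n m : ℕ) .{{_ : NonZero m}} → Set
LDow n m = Σ (Raw (2 ℕ.* n ℕ.∸ 1) m) λ f → Valid f × InL f

-- Poset isomorphism  L^m_{2n-1} ≅ L(H^m_{2n-1}):  a map φ sending each
-- labeled partition to a set of hyperplanes (whose intersection is the flat),
-- surjective onto flats and an order embedding (hence injective on flats,
-- as ≤D is antisymmetric).

LatticeIso : ∀ {c ℓ} (F : CommutativeRing c ℓ) (ω : CommutativeRing.Carrier F)
             (n m : ℕ) .{{_ : NonZero m}} → Set (c ⊔ ℓ)
LatticeIso F ω n m =
  Σ (LDow n m → List (Hyp n m)) λ φ →
    (∀ (S : List (Hyp n m)) → ∃ λ d → _≤L_ F ω S (φ d) × _≤L_ F ω (φ d) S)
    × (∀ (d d' : LDow n m) →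
         (Data.Product.proj₁ d ≤D Data.Product.proj₁ d') ⇔ _≤L_ F ω (φ d) (φ d'))

module Submission where

-- Write z_i = x_i - y_i and attach z_i to the odd element 2i+1 and x_{j+1}
-- to the even element 2j+2 of [2n-1].  In these coordinates the hyperplanes
-- are z_i = 0 and z_i = ω^l x_{j+1} (i ≤ j): each relates an odd element to
-- the zero block or to a larger even element.  A labeled partition f of
-- [2n-1] has a flat (t_i = 0 on the zero block, t_i = ω^a t_r on the block of
-- r with label a), and the map f ↦ {hyperplanes containing its flat} is the
-- isomorphism.

open import Defs
open import Level using (Level; _⊔_)
open import Algebra.Bundles using (CommutativeRing)
open import Data.Nat as ℕ using (ℕ; NonZero; zero; suc; z≤n; s≤s; _≤_; _∸_)
import Data.Nat.Properties as ℕP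
import Data.Nat.DivMod as DM
open DM using (_%_; _/_; _mod_; m≡m%n+[m/n]*n)
import Data.Nat.Induction as ℕI
open import Data.Fin as Fin using (Fin; toℕ; fromℕ<)
import Data.Fin.Properties as FinP
open import Data.Fin.Subset using (Subset; inside; ∣_∣) renaming (_∈_ to _∈ₛ_)
open import Data.Fin.Subset.Properties using (p⊂q⇒∣p∣<∣q∣)
open import Data.Maybe using (Maybe; just; nothing)
import Data.Maybe.Properties as MaybeP
open import Data.Product using (Σ; ∃; ∃₂; _×_; _,_; proj₁; proj₂)
import Data.Product.Properties as ProdP
open import Data.Sum using (_⊎_; inj₁; inj₂; [_,_]′)
open import Data.Empty using (⊥; ⊥-elim)
open import Data.Unit using (⊤; tt)
open import Data.Vec using (lookup; tabulate)
open import Data.Vec.Properties using (lookup∘tabulate; tabulate∘lookup; tabulate-cong; []=⇒lookup; lookup⇒[]=)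
open import Data.List using (List; []; _∷_; concatMap; filter; allFin)
open import Data.List.Membership.Propositional using (_∈_)
open import Data.List.Membership.Propositional.Properties using (∈-concatMap⁺; ∈-allFin; ∈-filter⁺; ∈-filter⁻)
open import Data.List.Relation.Unary.Any using (here; there)
import Data.List.Relation.Unary.Any as AnyM
open import Function using (_∘_)
open import Function.Bundles using (_⇔_; mk⇔; Equivalence)
open import Function.Properties.Equivalence using () renaming (trans to ⇔-trans)
open import Induction.WellFounded using (Acc; acc)
open import Relation.Binary using (Tri; tri<; tri≈; tri>)
open import Relation.Binary.Construct.Closure.ReflexiveTransitive using (ε; _◅_)
open import Relation.Binary.PropositionalEquality as ≡
  using (_≡_; _≢_; refl; sym; trans; cong; subst; subst₂; module ≡-Reasoning)
open import Relation.Nullary using (¬_; Dec; yes; no; does)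
open import Relation.Nullary.Decidable using (_×-dec_)

least : ∀ {K} (P : Fin K → Set) → (∀ i → Dec (P i)) → ∀ k → P k →
        ∃ λ i → P i × i Fin.≤ k × (∀ j → j Fin.< i → ¬ P j)
least {suc K} P P? k pk with P? Fin.zero
... | yes p0 = Fin.zero , p0 , z≤n , λ j ()
least {suc K} P P? Fin.zero    pk | no ¬p0 = ⊥-elim (¬p0 pk)
least {suc K} P P? (Fin.suc k) pk | no ¬p0 with least (P ∘ Fin.suc) (P? ∘ Fin.suc) k pk
... | i , pi , i≤k , below = Fin.suc i , pi , s≤s i≤k , below′
  where
  below′ : ∀ j → j Fin.< Fin.suc i → ¬ P j
  below′ Fin.zero    _         = ¬p0
  below′ (Fin.suc j) (s≤s j<i) = below j j<i

greatest : ∀ {K} (P : Fin K → Set) → (∀ i → Dec (P i)) → ∀ k → P k →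
           ∃ λ M → P M × (∀ j → P j → j Fin.≤ M)
greatest {suc K} P P? k pk with FinP.any? (P? ∘ Fin.suc)
... | yes (j , pj) with greatest (P ∘ Fin.suc) (P? ∘ Fin.suc) j pj
...   | M , pM , above = Fin.suc M , pM , above′
  where
  above′ : ∀ j → P j → j Fin.≤ Fin.suc M
  above′ Fin.zero    _  = z≤n
  above′ (Fin.suc j) pj = s≤s (above j pj)
greatest {suc K} P P? Fin.zero    pk | no none = Fin.zero , pk , above′
  where
  above′ : ∀ j → P j → j Fin.≤ Fin.zero {K}
  above′ Fin.zero    _  = z≤n
  above′ (Fin.suc j) pj = ⊥-elim (none (j , pj))
greatest {suc K} P P? (Fin.suc k) pk | no none = ⊥-elim (none (k , pk))

∈-concatMap : ∀ {A B : Set} (f : A → List B) {xs : List A} {y : B} x → x ∈ xs → y ∈ f x → y ∈ concatMap f xs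
∈-concatMap f x x∈xs y∈fx = ∈-concatMap⁺ f (AnyM.map (λ { refl → y∈fx }) x∈xs)

module Labels {m : ℕ} .{{_ : NonZero m}} where
  open ≡-Reasoning
  open import Data.Nat using (_+_)

  _-ₘ_ : Fin m → Fin m → Fin m
  a -ₘ b = (toℕ a + (m ∸ toℕ b)) DM.mod m

  toℕ-mod : ∀ k → toℕ (k DM.mod m) ≡ k % m
  toℕ-mod k = FinP.toℕ-fromℕ< (DM.m%n<n k m)

  %-absorbˡ : ∀ x y → (x % m + y) % m ≡ (x + y) % m
  %-absorbˡ x y = begin
    (x % m + y) % m           ≡⟨ DM.%-distribˡ-+ (x % m) y m ⟩
    (x % m % m + y % m) % m   ≡⟨ cong (λ z → (z + y % m) % m) (DM.m%n%n≡m%n x m) ⟩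
    (x % m + y % m) % m       ≡⟨ DM.%-distribˡ-+ x y m ⟨
    (x + y) % m ∎

  toℕ%m : (a : Fin m) → toℕ a % m ≡ toℕ a
  toℕ%m a = DM.m<n⇒m%n≡m (FinP.toℕ<n a)

  +ₘ-assoc : ∀ a b c → (a +ₘ b) +ₘ c ≡ a +ₘ (b +ₘ c)
  +ₘ-assoc a b c = FinP.toℕ-injective (begin
    toℕ ((a +ₘ b) +ₘ c)                ≡⟨ toℕ-mod _ ⟩
    (toℕ (a +ₘ b) + toℕ c) % m         ≡⟨ cong (λ z → (z + toℕ c) % m) (toℕ-mod _) ⟩
    ((toℕ a + toℕ b) % m + toℕ c) % m  ≡⟨ %-absorbˡ (toℕ a + toℕ b) (toℕ c) ⟩
    (toℕ a + toℕ b + toℕ c) % m        ≡⟨ cong (_% m) (ℕP.+-assoc (toℕ a) (toℕ b) (toℕ c)) ⟩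
    (toℕ a + (toℕ b + toℕ c)) % m      ≡⟨ cong (_% m) (ℕP.+-comm (toℕ a) _) ⟩
    (toℕ b + toℕ c + toℕ a) % m        ≡⟨ %-absorbˡ (toℕ b + toℕ c) (toℕ a) ⟨
    ((toℕ b + toℕ c) % m + toℕ a) % m  ≡⟨ cong (λ z → (z + toℕ a) % m) (toℕ-mod _) ⟨
    (toℕ (b +ₘ c) + toℕ a) % m         ≡⟨ cong (_% m) (ℕP.+-comm _ (toℕ a)) ⟩
    (toℕ a + toℕ (b +ₘ c)) % m         ≡⟨ toℕ-mod _ ⟨
    toℕ (a +ₘ (b +ₘ c)) ∎)

  +ₘ-identityʳ : ∀ a → a +ₘ zeroₘ ≡ a
  +ₘ-identityʳ a = FinP.toℕ-injective (begin
    toℕ (a +ₘ zeroₘ)               ≡⟨ toℕ-mod _ ⟩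
    (toℕ a + toℕ (zeroₘ {m})) % m  ≡⟨ cong (λ z → (toℕ a + z) % m) (toℕ-mod 0) ⟩
    (toℕ a + 0 % m) % m            ≡⟨ cong (_% m) (ℕP.+-comm (toℕ a) _) ⟩
    (0 % m + toℕ a) % m            ≡⟨ %-absorbˡ 0 (toℕ a) ⟩
    toℕ a % m                      ≡⟨ toℕ%m a ⟩
    toℕ a ∎)

  -ₘ+ₘ : ∀ a b → (a -ₘ b) +ₘ b ≡ a
  -ₘ+ₘ a b = FinP.toℕ-injective (begin
    toℕ ((a -ₘ b) +ₘ b)                          ≡⟨ toℕ-mod _ ⟩
    (toℕ (a -ₘ b) + toℕ b) % m                   ≡⟨ cong (λ z → (z + toℕ b) % m) (toℕ-mod _) ⟩
    ((toℕ a + (m ∸ toℕ b)) % m + toℕ b) % m      ≡⟨ %-absorbˡ _ (toℕ b) ⟩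
    (toℕ a + (m ∸ toℕ b) + toℕ b) % m            ≡⟨ cong (_% m) (ℕP.+-assoc (toℕ a) _ (toℕ b)) ⟩
    (toℕ a + ((m ∸ toℕ b) + toℕ b)) % m          ≡⟨ cong (λ z → (toℕ a + z) % m) (ℕP.m∸n+n≡m (ℕP.<⇒≤ (FinP.toℕ<n b))) ⟩
    (toℕ a + m) % m                              ≡⟨ DM.[m+n]%n≡m%n (toℕ a) m ⟩
    toℕ a % m                                    ≡⟨ toℕ%m a ⟩
    toℕ a ∎)

module Merges {N m : ℕ} .{{_ : NonZero m}} where

  Entry : Set
  Entry = Maybe (Fin N × Fin m)

  mergeZeroAt : Fin N → Entry → Entry
  mergeZeroAt r nothing = nothing
  mergeZeroAt r (just (s , a)) with r Fin.≟ s
  ... | yes _ = nothing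
  ... | no  _ = just (s , a)

  mergeBlocksAt : Fin N → Fin N → Fin m → Entry → Entry
  mergeBlocksAt r s l nothing = nothing
  mergeBlocksAt r s l (just (t , a)) with s Fin.≟ t
  ... | yes _ = just (r , a +ₘ l)
  ... | no  _ = just (t , a)

  -- They are defined through anonymous
  -- local functions, so the unfolded entry is obtained by unification: the
  -- left-hand side of `mergeZero-entry` is solved by its use in
  -- `lookup-mergeZero`, which precedes it in the mutual block.
  mutual
    lookup-mergeZero : ∀ (f : Raw N m) r i → lookup (mergeZero f r) i ≡ mergeZeroAt r (lookup f i)
    lookup-mergeZero f r i = trans (lookup∘tabulate _ i) (mergeZero-entry f r i)

    mergeZero-entry : ∀ (f : Raw N m) r i → _ ≡ mergeZeroAt r (lookup f i)
    mergeZero-entry f r i with lookup f i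
    ... | nothing = refl
    ... | just (s , a) with r Fin.≟ s
    ...   | yes _ = refl
    ...   | no  _ = refl

  mutual
    lookup-mergeBlocks : ∀ (f : Raw N m) r s l i →
                         lookup (mergeBlocks f r s l) i ≡ mergeBlocksAt r s l (lookup f i)
    lookup-mergeBlocks f r s l i = trans (lookup∘tabulate _ i) (mergeBlocks-entry f r s l i)

    mergeBlocks-entry : ∀ (f : Raw N m) r s l i → _ ≡ mergeBlocksAt r s l (lookup f i)
    mergeBlocks-entry f r s l i with lookup f i
    ... | nothing = refl
    ... | just (t , a) with s Fin.≟ t
    ...   | yes _ = refl
    ...   | no  _ = refl

  just≢nothing : ∀ {v : Fin N × Fin m} → just v ≢ nothing
  just≢nothing ()

  _≟ₑ_ : (u v : Entry) → Dec (u ≡ v)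
  _≟ₑ_ = MaybeP.≡-dec (ProdP.≡-dec FinP._≟_ FinP._≟_)

  data MergeZeroView (r : Fin N) : Entry → Entry → Set where
    zero-block : MergeZeroView r nothing nothing
    absorbed   : ∀ a → MergeZeroView r (just (r , a)) nothing
    untouched  : ∀ s a → r ≢ s → MergeZeroView r (just (s , a)) (just (s , a))

  data MergeBlocksView (r s : Fin N) (l : Fin m) : Entry → Entry → Set where
    zero-block : MergeBlocksView r s l nothing nothing
    moved      : ∀ a → MergeBlocksView r s l (just (s , a)) (just (r , a +ₘ l))
    untouched  : ∀ t a → s ≢ t → MergeBlocksView r s l (just (t , a)) (just (t , a))

  mergeZeroAt-view : ∀ r v → MergeZeroView r v (mergeZeroAt r v)
  mergeZeroAt-view r nothing = zero-block
  mergeZeroAt-view r (just (s , a)) with r Fin.≟ s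
  ... | yes refl = absorbed a
  ... | no  r≢s  = untouched s a r≢s

  mergeBlocksAt-view : ∀ r s l v → MergeBlocksView r s l v (mergeBlocksAt r s l v)
  mergeBlocksAt-view r s l nothing = zero-block
  mergeBlocksAt-view r s l (just (t , a)) with s Fin.≟ t
  ... | yes refl = moved a
  ... | no  s≢t  = untouched t a s≢t

  mz-view : ∀ (f : Raw N m) r i → MergeZeroView r (lookup f i) (lookup (mergeZero f r) i)
  mz-view f r i = subst (MergeZeroView r _) (sym (lookup-mergeZero f r i)) (mergeZeroAt-view r _)

  mb-view : ∀ (f : Raw N m) r s l i → MergeBlocksView r s l (lookup f i) (lookup (mergeBlocks f r s l) i)
  mb-view f r s l i = subst (MergeBlocksView r s l _) (sym (lookup-mergeBlocks f r s l i)) (mergeBlocksAt-view r s l _)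

  module _ (f : Raw N m) (r : Fin N) where
    mz-nothing : ∀ {i} → lookup f i ≡ nothing → lookup (mergeZero f r) i ≡ nothing
    mz-nothing {i} e with lookup f i | lookup (mergeZero f r) i | mz-view f r i
    ... | _ | _ | zero-block = refl

    mz-absorbs : ∀ {i a} → lookup f i ≡ just (r , a) → lookup (mergeZero f r) i ≡ nothing
    mz-absorbs {i} e with lookup f i | lookup (mergeZero f r) i | mz-view f r i
    mz-absorbs refl | _ | _ | absorbed _ = refl
    mz-absorbs refl | _ | _ | untouched _ _ r≢r = ⊥-elim (r≢r refl)

    mz-keeps : ∀ {i s a} → lookup f i ≡ just (s , a) → r ≢ s → lookup (mergeZero f r) i ≡ just (s , a)
    mz-keeps {i} e r≢s with lookup f i | lookup (mergeZero f r) i | mz-view f r i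
    mz-keeps refl r≢r | _ | _ | absorbed _ = ⊥-elim (r≢r refl)
    mz-keeps refl r≢s | _ | _ | untouched _ _ _ = refl

    mz-just⁻ : ∀ {i s a} → lookup (mergeZero f r) i ≡ just (s , a) → lookup f i ≡ just (s , a) × r ≢ s
    mz-just⁻ {i} e with lookup f i | lookup (mergeZero f r) i | mz-view f r i
    mz-just⁻ refl | _ | _ | untouched _ _ r≢s = refl , r≢s

    mz-valid : Valid f → Valid (mergeZero f r)
    mz-valid V i s a e with mz-just⁻ e
    ... | fi , r≢s = proj₁ (V i s a fi) , mz-keeps (proj₂ (V i s a fi)) r≢s

  module _ (f : Raw N m) (r s : Fin N) (l : Fin m) where
    mb-nothing : ∀ {i} → lookup f i ≡ nothing → lookup (mergeBlocks f r s l) i ≡ nothing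
    mb-nothing {i} e with lookup f i | lookup (mergeBlocks f r s l) i | mb-view f r s l i
    ... | _ | _ | zero-block = refl

    mb-moves : ∀ {i a} → lookup f i ≡ just (s , a) → lookup (mergeBlocks f r s l) i ≡ just (r , a +ₘ l)
    mb-moves {i} e with lookup f i | lookup (mergeBlocks f r s l) i | mb-view f r s l i
    mb-moves refl | _ | _ | moved _ = refl
    mb-moves refl | _ | _ | untouched _ _ s≢s = ⊥-elim (s≢s refl)

    mb-keeps : ∀ {i t a} → lookup f i ≡ just (t , a) → s ≢ t → lookup (mergeBlocks f r s l) i ≡ just (t , a)
    mb-keeps {i} e s≢t with lookup f i | lookup (mergeBlocks f r s l) i | mb-view f r s l i
    mb-keeps refl s≢s | _ | _ | moved _ = ⊥-elim (s≢s refl)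
    mb-keeps refl _   | _ | _ | untouched _ _ _ = refl

    mb-nothing⁻ : ∀ {i} → lookup (mergeBlocks f r s l) i ≡ nothing → lookup f i ≡ nothing
    mb-nothing⁻ {i} e with lookup f i | lookup (mergeBlocks f r s l) i | mb-view f r s l i
    mb-nothing⁻ refl | _ | _ | zero-block = refl

    mb-just⁻ : ∀ {i q a} → lookup (mergeBlocks f r s l) i ≡ just (q , a) →
               (q ≡ r × ∃ λ a₀ → lookup f i ≡ just (s , a₀)) ⊎ (lookup f i ≡ just (q , a) × s ≢ q)
    mb-just⁻ {i} e with lookup f i | lookup (mergeBlocks f r s l) i | mb-view f r s l i
    mb-just⁻ refl | _ | _ | moved a₀ = inj₁ (refl , a₀ , refl)
    mb-just⁻ refl | _ | _ | untouched _ _ s≢q = inj₂ (refl , s≢q)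

    mb-valid : Valid f → IsBlockMin f r → r Fin.< s → Valid (mergeBlocks f r s l)
    mb-valid V mr r<s i q a e with mb-just⁻ e
    ... | inj₁ (refl , a₀ , fi) = FinP.≤-trans (ℕP.<⇒≤ r<s) (proj₁ (V i s a₀ fi)) , mb-keeps mr (λ s≡r → FinP.<⇒≢ r<s (sym s≡r))
    ... | inj₂ (fi , s≢q) = proj₁ (V i q a fi) , mb-keeps (proj₂ (V i q a fi)) s≢q

  inBlock? : ∀ (f : Raw N m) r i → Dec (InBlock f r i)
  inBlock? f r i with lookup f i
  ... | nothing       = no λ ()
  ... | just (r' , a) with r' FinP.≟ r
  ...   | yes refl = yes (a , refl)
  ...   | no r'≢r  = no λ { (_ , refl) → r'≢r refl }

  -- The number of nonzero blocks, counted through their minima; every merge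
  -- decreases it, which makes it a termination measure.

  isBlockMin? : (f : Raw N m) (r : Fin N) → Dec (IsBlockMin f r)
  isBlockMin? f r = lookup f r ≟ₑ just (r , zeroₘ)

  blockMins : Raw N m → Subset N
  blockMins f = tabulate (λ r → does (isBlockMin? f r))

  #blocks : Raw N m → ℕ
  #blocks f = ∣ blockMins f ∣

  ∈-blockMins⁺ : ∀ f {r} → IsBlockMin f r → r ∈ₛ blockMins f
  ∈-blockMins⁺ f {r} mr = lookup⇒[]= r (blockMins f) (trans (lookup∘tabulate _ r) (isYes mr))
    where
    isYes : IsBlockMin f r → does (isBlockMin? f r) ≡ inside
    isYes mr with isBlockMin? f r
    ... | yes _  = refl
    ... | no ¬mr = ⊥-elim (¬mr mr)

  ∈-blockMins⁻ : ∀ f {r} → r ∈ₛ blockMins f → IsBlockMin f r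
  ∈-blockMins⁻ f {r} r∈ = fromYes (trans (sym (lookup∘tabulate _ r)) ([]=⇒lookup r∈))
    where
    fromYes : does (isBlockMin? f r) ≡ inside → IsBlockMin f r
    fromYes eq with isBlockMin? f r
    ... | yes mr = mr

  fewer-blocks : ∀ f g s → (∀ {x} → IsBlockMin g x → IsBlockMin f x) →
                 IsBlockMin f s → ¬ IsBlockMin g s → #blocks g ℕ.< #blocks f
  fewer-blocks f g s g⊆f ms ¬ms = p⊂q⇒∣p∣<∣q∣
    ((λ x∈ → ∈-blockMins⁺ f (g⊆f (∈-blockMins⁻ g x∈))) , s , ∈-blockMins⁺ f ms , λ s∈ → ¬ms (∈-blockMins⁻ g s∈))

  mz-fewer : ∀ f r → IsBlockMin f r → #blocks (mergeZero f r) ℕ.< #blocks f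
  mz-fewer f r mr = fewer-blocks f (mergeZero f r) r (λ gx → proj₁ (mz-just⁻ f r gx)) mr
    (λ gr → just≢nothing (trans (sym gr) (mz-absorbs f r mr)))

  mb-fewer : ∀ f r s l → IsBlockMin f r → IsBlockMin f s → r Fin.< s →
             #blocks (mergeBlocks f r s l) ℕ.< #blocks f
  mb-fewer f r s l mr ms r<s = fewer-blocks f (mergeBlocks f r s l) s min⁻ ms s-absorbed
    where
    min⁻ : ∀ {x} → IsBlockMin (mergeBlocks f r s l) x → IsBlockMin f x
    min⁻ gx with mb-just⁻ f r s l gx
    ... | inj₁ (refl , _) = mr
    ... | inj₂ (fx , _)   = fx
    s-absorbed : ¬ IsBlockMin (mergeBlocks f r s l) s
    s-absorbed gs = FinP.<⇒≢ r<s (cong proj₁ (MaybeP.just-injective (trans (sym (mb-moves f r s l ms)) gs)))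

parity : ∀ {N} (k : Fin N) → OddElt k ⊎ EvenElt k
parity k with suc (toℕ k) DM.% 2 | DM.m%n<n (suc (toℕ k)) 2
... | 0 | _ = inj₂ refl
... | 1 | _ = inj₁ refl
... | suc (suc _) | s≤s (s≤s ())

odd≢even : ∀ {N} (k k' : Fin N) → OddElt k → EvenElt k' → k ≢ k'
odd≢even k k' ok ek' refl with trans (sym ok) ek'
... | ()

-- The shape invariant.  `Shaped f` is a local reformulation of the
-- defining conditions of L^m_{2n-1} which is visibly preserved by the
-- merges used to build flats, and it implies `InL f`.

module Shape {N m : ℕ} .{{_ : NonZero m}} where
  open Merges {N} {m}

  OddBelowInZero : Raw N m → Fin N → Set
  OddBelowInZero f e = ∃ λ o → OddElt o × o Fin.< e × lookup f o ≡ nothing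

  record Shaped (f : Raw N m) : Set where
    field
      zero-even   : ∀ e → EvenElt e → lookup f e ≡ nothing → OddBelowInZero f e
      even-min    : ∀ e → EvenElt e → IsBlockMin f e → ∀ i → InBlock f e i → i ≡ e
      odd-not-max : ∀ o r → OddElt o → InBlock f r o → ∀ i → InBlock f r i → i ≢ o →
                    ∃ λ j → InBlock f r j × o Fin.< j

  JoinsZero : Raw N m → Fin N → Set
  JoinsZero f r = ∃ λ e → InBlock f r e × (OddElt e ⊎ OddBelowInZero f e)

  Linked : Raw N m → Fin N → Fin N → Set
  Linked f r s = ∃₂ λ k k' → OddElt k × EvenElt k' × k Fin.< k' ×
                   ((InBlock f r k × InBlock f s k') ⊎ (InBlock f s k × InBlock f r k'))

  mz-shaped : ∀ f r → Valid f → Shaped f → IsBlockMin f r → JoinsZero f r → Shaped (mergeZero f r)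
  mz-shaped f r V S mr (e , e∈r , ok-or-below) = record
    { zero-even   = zero-even′
    ; even-min    = λ e ev ge i (a , gi) → even-min e ev (proj₁ (mz-just⁻ f r ge)) i (a , proj₁ (mz-just⁻ f r gi))
    ; odd-not-max = odd-not-max′
    }
    where
    open Shaped S
    g : Raw N m
    g = mergeZero f r
    below-zero : ∀ {x} → OddBelowInZero f x → OddBelowInZero g x
    below-zero (o , oo , o<x , fo) = o , oo , o<x , mz-nothing f r fo
    r-ok : OddElt r ⊎ OddBelowInZero f r
    r-ok with parity r
    ... | inj₁ or = inj₁ or
    ... | inj₂ er with even-min r er mr e e∈r
    ...   | refl = ok-or-below
    zero-even′ : ∀ x → EvenElt x → lookup g x ≡ nothing → OddBelowInZero g x
    zero-even′ x ex gx with lookup f x in fx | lookup g x | mz-view f r x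
    ... | _ | _ | zero-block = below-zero (zero-even x ex fx)
    ... | _ | _ | absorbed a with r FinP.≟ x | r-ok | proj₁ (V x r a fx)
    ...   | yes refl | inj₁ or    | _   = ⊥-elim (odd≢even r r or ex refl)
    ...   | yes refl | inj₂ below | _   = below-zero below
    ...   | no r≢x   | inj₁ or    | r≤x = r , or , FinP.≤∧≢⇒< r≤x r≢x , mz-absorbs f r mr
    ...   | no r≢x   | inj₂ (o , oo , o<r , fo) | r≤x =
      o , oo , FinP.<-trans o<r (FinP.≤∧≢⇒< r≤x r≢x) , mz-nothing f r fo
    odd-not-max′ : ∀ o q → OddElt o → InBlock g q o → ∀ i → InBlock g q i → i ≢ o →
                   ∃ λ j → InBlock g q j × o Fin.< j
    odd-not-max′ o q oo (a , go) i (b , gi) i≢o with mz-just⁻ f r go | mz-just⁻ f r gi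
    ... | fo , r≢q | fi , _ with odd-not-max o q oo (a , fo) i (b , fi) i≢o
    ... | j , (c , fj) , o<j = j , (c , mz-keeps f r fj r≢q) , o<j

  module LinkedMerge (f : Raw N m) (r s : Fin N) (l : Fin m) (V : Valid f) (S : Shaped f)
                     (r<s : r Fin.< s) (k k' : Fin N) (ok : OddElt k) (ek' : EvenElt k') (k<k' : k Fin.< k')
                     (sides : (InBlock f r k × InBlock f s k') ⊎ (InBlock f s k × InBlock f r k')) where
    open Shaped S
    private
      g : Raw N m
      g = mergeBlocks f r s l

    s≢r : s ≢ r
    s≢r s≡r = FinP.<⇒≢ r<s (sym s≡r)

    merged : ∀ {j} → InBlock f r j ⊎ InBlock f s j → InBlock g r j
    merged (inj₁ (c , fj)) = c , mb-keeps f r s l fj s≢r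
    merged (inj₂ (c , fj)) = c +ₘ l , mb-moves f r s l fj

    k'-merged : InBlock g r k'
    k'-merged = [ (λ (_ , k'∈s) → merged (inj₂ k'∈s)) , (λ (_ , k'∈r) → merged (inj₁ k'∈r)) ]′ sides

    -- r is not an even minimum: that block would be the singleton {r}
    r-not-even-min : EvenElt r → IsBlockMin f r → ⊥
    r-not-even-min er mr = [ k-in-r , k'-in-r ]′ sides
      where
      k-in-r : InBlock f r k × InBlock f s k' → ⊥
      k-in-r (k∈r , _) = odd≢even k r ok er (even-min r er mr k k∈r)
      -- then k' = r, but the block of s contains k < k'
      k'-in-r : InBlock f s k × InBlock f r k' → ⊥
      k'-in-r ((a , fk) , k'∈r) with even-min r er mr k' k'∈r
      ... | refl = FinP.<-irrefl refl (FinP.<-trans r<s (ℕP.≤-<-trans (proj₁ (V k s a fk)) k<k'))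

    merged-even-min : ∀ e → EvenElt e → IsBlockMin g e → ∀ i → InBlock g e i → i ≡ e
    merged-even-min e ev ge i (b , gi) with mb-just⁻ f r s l ge
    ... | inj₁ (refl , a₀ , fe) = ⊥-elim (FinP.<-irrefl refl (ℕP.<-≤-trans r<s (proj₁ (V e s a₀ fe))))
    ... | inj₂ (fe , _) with mb-just⁻ f r s l gi
    ...   | inj₁ (refl , _) = ⊥-elim (r-not-even-min ev fe)
    ...   | inj₂ (fi , _)   = even-min e ev fe i (b , fi)

    above-in-union : ∀ o X → OddElt o → InBlock f X o → InBlock f X k ⊎ InBlock f X k' →
                     (∀ {j} → InBlock f X j → InBlock g r j) →
                     ∃ λ j → InBlock g r j × o Fin.< j
    above-in-union o X oo o∈X (inj₁ k∈X) lift with k FinP.≟ o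
    ... | yes refl = k' , k'-merged , k<k'
    ... | no k≢o with odd-not-max o X oo o∈X k k∈X k≢o
    ...   | j , j∈X , o<j = j , lift j∈X , o<j
    above-in-union o X oo o∈X (inj₂ k'∈X) lift with odd-not-max o X oo o∈X k' k'∈X (odd≢even o k' oo ek' ∘ sym)
    ... | j , j∈X , o<j = j , lift j∈X , o<j

    r-side : InBlock f r k ⊎ InBlock f r k'
    r-side = [ inj₁ ∘ proj₁ , inj₂ ∘ proj₂ ]′ sides

    s-side : InBlock f s k ⊎ InBlock f s k'
    s-side = [ inj₂ ∘ proj₂ , inj₁ ∘ proj₁ ]′ sides

    merged-odd-not-max : ∀ o q → OddElt o → InBlock g q o → ∀ i → InBlock g q i → i ≢ o →
                         ∃ λ j → InBlock g q j × o Fin.< j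
    merged-odd-not-max o q oo (a , go) i (b , gi) i≢o with mb-just⁻ f r s l go
    ... | inj₁ (refl , a₀ , fo) = above-in-union o s oo (a₀ , fo) s-side (merged ∘ inj₂)
    ... | inj₂ (fo , s≢q) with q FinP.≟ r
    ...   | yes refl = above-in-union o r oo (a , fo) r-side (merged ∘ inj₁)
    ...   | no q≢r with mb-just⁻ f r s l gi
    ...     | inj₁ (q≡r , _) = ⊥-elim (q≢r q≡r)
    ...     | inj₂ (fi , _) with odd-not-max o q oo (a , fo) i (b , fi) i≢o
    ...       | j , (c , fj) , o<j = j , (c , mb-keeps f r s l fj s≢q) , o<j

  mb-shaped : ∀ f r s l → Valid f → Shaped f → r Fin.< s → Linked f r s → Shaped (mergeBlocks f r s l)
  mb-shaped f r s l V S r<s (k , k' , ok , ek' , k<k' , sides) = record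
    { zero-even   = λ e ev ge → below-zero (zero-even e ev (mb-nothing⁻ f r s l ge))
    ; even-min    = merged-even-min
    ; odd-not-max = merged-odd-not-max
    }
    where
    open Shaped S
    open LinkedMerge f r s l V S r<s k k' ok ek' k<k' sides
    below-zero : ∀ {x} → OddBelowInZero f x → OddBelowInZero (mergeBlocks f r s l) x
    below-zero (o , oo , o<x , fo) = o , oo , o<x , mb-nothing f r s l fo

  Shaped⇒InL : ∀ f → Shaped f → InL f
  Shaped⇒InL f S = min-zero-odd , block-shape
    where
    open Shaped S
    min-zero-odd : ∀ i → lookup f i ≡ nothing → (∀ j → j Fin.< i → lookup f j ≢ nothing) → OddElt i
    min-zero-odd i fi none-below with parity i
    ... | inj₁ oi = oi
    ... | inj₂ ei with zero-even i ei fi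
    ...   | o , _ , o<i , fo = ⊥-elim (none-below o o<i fo)
    block-shape : ∀ r → IsBlockMin f r → (∃ λ i → InBlock f r i × i ≢ r) →
                  OddElt r × (∀ M → InBlock f r M → (∀ j → InBlock f r j → j Fin.≤ M) → EvenElt M)
    block-shape r mr (i , i∈r , i≢r) = r-odd , max-even
      where
      r-odd : OddElt r
      r-odd with parity r
      ... | inj₁ or = or
      ... | inj₂ er = ⊥-elim (i≢r (even-min r er mr i i∈r))
      other-than : ∀ M → ∃ λ x → InBlock f r x × x ≢ M
      other-than M with r FinP.≟ M
      ... | yes refl = i , i∈r , i≢r
      ... | no r≢M  = r , (zeroₘ , mr) , r≢M
      max-even : ∀ M → InBlock f r M → (∀ j → InBlock f r j → j Fin.≤ M) → EvenElt M
      max-even M M∈r M-max with parity M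
      ... | inj₂ eM = eM
      ... | inj₁ oM with other-than M
      ...   | x , x∈r , x≢M with odd-not-max M r oM M∈r x x∈r x≢M
      ...     | j , j∈r , M<j = ⊥-elim (ℕP.<-irrefl refl (ℕP.<-≤-trans M<j (M-max j j∈r)))

  discrete : Raw N m
  discrete = tabulate (λ i → just (i , zeroₘ))

  discrete-at : ∀ i → lookup discrete i ≡ just (i , zeroₘ)
  discrete-at i = lookup∘tabulate _ i

  discrete-block : ∀ {r i a} → lookup discrete i ≡ just (r , a) → i ≡ r
  discrete-block {i = i} e = cong proj₁ (MaybeP.just-injective (trans (sym (discrete-at i)) e))

  discrete-valid : Valid discrete
  discrete-valid i r a e with discrete-block e
  ... | refl = FinP.≤-refl , discrete-at i

  discrete-shaped : Shaped discrete
  discrete-shaped = record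
    { zero-even   = λ e _ de → ⊥-elim (just≢nothing (trans (sym (discrete-at e)) de))
    ; even-min    = λ e _ _ i (_ , di) → discrete-block di
    ; odd-not-max = λ o r _ (_ , dₒ) i (_ , dᵢ) i≢o → ⊥-elim (i≢o (trans (discrete-block dᵢ) (sym (discrete-block dₒ))))
    }

-- Reflecting the order.  `Refines f` says that every relation recorded by
-- f (t_i = 0, resp. t_i = ω^a t_s) is a consequence of those recorded by
-- f'.  A refining f can be merged step by step until it becomes f',
-- so f ≤D f'.

module Refinement {N m : ℕ} .{{_ : NonZero m}} (f' : Raw N m) (V' : Valid f') where
  open Merges {N} {m}
  open Labels {m}
  open ≡-Reasoning

  -- the relation recorded by the entry at i holds on the flat of f':
  -- with s in the block of q (label b') in f', i lies in that block with
  -- label a + b', or i and s are both in the zero block of f'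
  Consistent : Fin N → Entry → Set
  Consistent i nothing        = lookup f' i ≡ nothing
  Consistent i (just (s , a)) =
      (lookup f' i ≡ nothing × lookup f' s ≡ nothing)
    ⊎ (∃₂ λ q b → ∃ λ b' → lookup f' i ≡ just (q , b) × lookup f' s ≡ just (q , b') × b ≡ a +ₘ b')

  Refines : Raw N m → Set
  Refines f = ∀ i → Consistent i (lookup f i)

  SameBlock : Entry → Entry → Set
  SameBlock (just (q , _)) (just (q' , _)) = q ≡ q'
  SameBlock _              _               = ⊥

  sameBlock? : ∀ u v → Dec (SameBlock u v)
  sameBlock? nothing        _               = no λ ()
  sameBlock? (just _)       nothing         = no λ ()
  sameBlock? (just (q , _)) (just (q' , _)) = q FinP.≟ q'

  ZeroMerge : Raw N m → Set
  ZeroMerge f = ∃ λ r → IsBlockMin f r × lookup f' r ≡ nothing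

  BlockMerge : Raw N m → Set
  BlockMerge f = ∃₂ λ r s → r Fin.< s × IsBlockMin f r × IsBlockMin f s × SameBlock (lookup f' r) (lookup f' s)

  zeroMerge? : ∀ f → Dec (ZeroMerge f)
  zeroMerge? f = FinP.any? (λ r → isBlockMin? f r ×-dec (lookup f' r ≟ₑ nothing))

  blockMerge? : ∀ f → Dec (BlockMerge f)
  blockMerge? f = FinP.any? λ r → FinP.any? λ s →
    (r FinP.<? s) ×-dec isBlockMin? f r ×-dec isBlockMin? f s ×-dec sameBlock? (lookup f' r) (lookup f' s)

  Progress : Raw N m → Set
  Progress f = ∃ λ g → Cover f g × #blocks g ℕ.< #blocks f × Valid g × Refines g

  zero-merge-step : ∀ f → Valid f → Refines f → ZeroMerge f → Progress f
  zero-merge-step f V R (r , mr , f'r) = mergeZero f r , coverZero f r mr , mz-fewer f r mr , mz-valid f r V , Rg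
    where
    Rg : Refines (mergeZero f r)
    Rg i with lookup f i | lookup (mergeZero f r) i | mz-view f r i | R i
    ... | _ | _ | zero-block      | c = c
    ... | _ | _ | absorbed _      | inj₁ (f'i , _) = f'i
    ... | _ | _ | absorbed _      | inj₂ (_ , _ , _ , _ , f'r′ , _) = ⊥-elim (just≢nothing (trans (sym f'r′) f'r))
    ... | _ | _ | untouched _ _ _ | c = c

  block-merge-step : ∀ f → Valid f → Refines f → BlockMerge f → Progress f
  block-merge-step f V R (r , s , r<s , mr , ms , same)
    with lookup f' r in f'r | lookup f' s in f's | same
  ... | just (q , b) | just (.q , b') | refl =
    g , coverBlocks f r s l mr ms r<s , mb-fewer f r s l mr ms r<s , mb-valid f r s l V mr r<s , Rg
    where
    l : Fin m
    l = b' -ₘ b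
    g : Raw N m
    g = mergeBlocks f r s l
    relabel : ∀ a → a +ₘ b' ≡ (a +ₘ l) +ₘ b
    relabel a = begin
      a +ₘ b'              ≡⟨ cong (a +ₘ_) (-ₘ+ₘ b' b) ⟨
      a +ₘ (l +ₘ b)        ≡⟨ +ₘ-assoc a l b ⟨
      (a +ₘ l) +ₘ b ∎
    Rg : Refines g
    Rg i with lookup f i | lookup g i | mb-view f r s l i | R i
    ... | _ | _ | zero-block      | c = c
    ... | _ | _ | untouched _ _ _ | c = c
    ... | _ | _ | moved a         | inj₁ (_ , f's′) = ⊥-elim (just≢nothing (trans (sym f's) f's′))
    ... | _ | _ | moved a         | inj₂ (_ , b₃ , _ , f'i , f's′ , b₃≡) with trans (sym f's) f's′
    ...   | refl = inj₂ (q , b₃ , b , f'i , f'r , trans b₃≡ (relabel a))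

  settled : ∀ f → Valid f → Refines f → ¬ ZeroMerge f → ¬ BlockMerge f → f ≡ f'
  settled f V R ¬zm ¬bm = begin
    f                    ≡⟨ tabulate∘lookup f ⟨
    tabulate (lookup f)  ≡⟨ tabulate-cong same-entry ⟩
    tabulate (lookup f') ≡⟨ tabulate∘lookup f' ⟩
    f' ∎
    where
    same-entry : ∀ i → lookup f i ≡ lookup f' i
    same-entry i with lookup f i in fi | R i
    ... | nothing      | f'i = sym f'i
    ... | just (r , a) | inj₁ (_ , f'r) = ⊥-elim (¬zm (r , proj₂ (V i r a fi) , f'r))
    ... | just (r , a) | inj₂ (q , b , b' , f'i , f'r , b≡) = same-block (lookup f q) refl (R q)
      where
      mr : IsBlockMin f r
      mr = proj₂ (V i r a fi)
      q≤r : q Fin.≤ r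
      q≤r = proj₁ (V' r q b' f'r)
      mq' : lookup f' q ≡ just (q , zeroₘ)
      mq' = proj₂ (V' r q b' f'r)
      -- the minimum q of the block of f' containing r is in the block of r in f,
      -- so q = r and the labels agree
      same-block : ∀ v → lookup f q ≡ v → Consistent q v → just (r , a) ≡ lookup f' i
      same-block nothing _ f'q = ⊥-elim (just≢nothing (trans (sym mq') f'q))
      same-block (just (r₂ , a₂)) fq (inj₁ (f'q , _)) = ⊥-elim (just≢nothing (trans (sym mq') f'q))
      same-block (just (r₂ , a₂)) fq (inj₂ (_ , _ , _ , f'q , f'r₂ , _))
        with trans (sym mq') f'q | FinP.<-cmp r r₂
      ... | refl | tri< r<r₂ _ _ = ⊥-elim (¬bm (r , r₂ , r<r₂ , mr , proj₂ (V q r₂ a₂ fq) , subst₂ SameBlock (sym f'r) (sym f'r₂) refl))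
      ... | refl | tri> _ _ r₂<r = ⊥-elim (¬bm (r₂ , r , r₂<r , proj₂ (V q r₂ a₂ fq) , mr , subst₂ SameBlock (sym f'r₂) (sym f'r) refl))
      ... | refl | tri≈ _ refl _ with FinP.≤-antisym q≤r (proj₁ (V q r a₂ fq))
      ...   | refl with trans (sym f'r) mq'
      ...     | refl = sym (trans f'i (cong (λ c → just (q , c)) (trans b≡ (+ₘ-identityʳ a))))

  refines⇒≤D : ∀ f → Valid f → Refines f → f ≤D f'
  refines⇒≤D f V R = towards f (ℕI.<-wellFounded (#blocks f)) V R
    where
    towards : ∀ f → Acc ℕ._<_ (#blocks f) → Valid f → Refines f → f ≤D f'
    towards f (acc smaller) V R with zeroMerge? f | blockMerge? f
    ... | yes zm | _ with zero-merge-step f V R zm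
    ...   | g , f⋖g , fewer , Vg , Rg = f⋖g ◅ towards g (smaller fewer) Vg Rg
    towards f (acc smaller) V R | no _ | yes bm with block-merge-step f V R bm
    ...   | g , f⋖g , fewer , Vg , Rg = f⋖g ◅ towards g (smaller fewer) Vg Rg
    towards f (acc smaller) V R | no ¬zm | no ¬bm = subst (f ≤D_) (settled f V R ¬zm ¬bm) ε

module RootsOfUnity {c ℓ : Level} (F : CommutativeRing c ℓ) (isField : IsField F) (charZero : CharZero F)
                    {m : ℕ} .{{_ : NonZero m}} (ω : CommutativeRing.Carrier F) (prim : PrimitiveRoot F m ω) where
  open CommutativeRing F renaming (refl to ≈-refl; sym to ≈-sym; trans to ≈-trans; reflexive to ≈-reflexive)
  open import Relation.Binary.Reasoning.Setoid setoid
  open import Algebra.Properties.Group (CommutativeRing.+-group F) using (identityʳ-unique; x∙y⁻¹≈ε⇒x≈y; x≈y⇒x∙y⁻¹≈ε)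
  open import Algebra.Properties.Ring ring using (-‿distribˡ-*)
  open import Algebra.Properties.CommutativeSemiring.Exp commutativeSemiring using (_^_; ^-homo-*; ^-assocʳ; ^-distrib-*; ^-congˡ)
  open import Algebra.Properties.Semiring.Mult semiring using (×1-homo-*) renaming (_×_ to _×ₙ_)
  open import Algebra.Properties.Monoid.Mult +-monoid using (×-homo-+)
  open Labels {m}

  pow≡^ : ∀ x k → pow F x k ≡ x ^ k
  pow≡^ x zero    = refl
  pow≡^ x (suc k) = cong (x *_) (pow≡^ x k)

  natF≡× : ∀ k → natF F k ≡ k ×ₙ 1#
  natF≡× zero    = refl
  natF≡× (suc k) = cong (1# +_) (natF≡× k)

  ζ : Fin m → Carrier
  ζ a = ω ^ toℕ a

  ω^m≈1 : ω ^ m ≈ 1#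
  ω^m≈1 = ≈-trans (≈-reflexive (≡.sym (pow≡^ ω m))) (proj₁ prim)

  ω^[q*m]≈1 : ∀ q → ω ^ (q ℕ.* m) ≈ 1#
  ω^[q*m]≈1 zero    = ≈-refl
  ω^[q*m]≈1 (suc q) = begin
    ω ^ (m ℕ.+ q ℕ.* m)      ≈⟨ ^-homo-* ω m (q ℕ.* m) ⟩
    ω ^ m * ω ^ (q ℕ.* m)    ≈⟨ *-cong ω^m≈1 (ω^[q*m]≈1 q) ⟩
    1# * 1#                  ≈⟨ *-identityˡ 1# ⟩
    1# ∎

  ω^-mod : ∀ k → ω ^ (k % m) ≈ ω ^ k
  ω^-mod k = begin
    ω ^ (k % m)                          ≈⟨ *-identityʳ _ ⟨
    ω ^ (k % m) * 1#                     ≈⟨ *-congˡ (ω^[q*m]≈1 (k / m)) ⟨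
    ω ^ (k % m) * ω ^ ((k / m) ℕ.* m)    ≈⟨ ^-homo-* ω (k % m) _ ⟨
    ω ^ (k % m ℕ.+ (k / m) ℕ.* m)        ≡⟨ cong (ω ^_) (m≡m%n+[m/n]*n k m) ⟨
    ω ^ k ∎

  ζ-mod : ∀ k → ζ (k mod m) ≈ ω ^ k
  ζ-mod k = ≈-trans (≈-reflexive (cong (ω ^_) (toℕ-mod k))) (ω^-mod k)

  ζ-hom : ∀ a b → ζ (a +ₘ b) ≈ ζ a * ζ b
  ζ-hom a b = ≈-trans (ζ-mod (toℕ a ℕ.+ toℕ b)) (^-homo-* ω (toℕ a) (toℕ b))

  ζ-zero : ζ zeroₘ ≈ 1#
  ζ-zero = ζ-mod 0

  ζ-zero+ : ∀ a → ζ (zeroₘ +ₘ a) ≈ ζ a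
  ζ-zero+ a = ≈-trans (ζ-hom zeroₘ a) (≈-trans (*-congʳ ζ-zero) (*-identityˡ (ζ a)))

  ζ-sub : ∀ a b → ζ (a -ₘ b) * ζ b ≈ ζ a
  ζ-sub a b = ≈-trans (≈-sym (ζ-hom (a -ₘ b) b)) (≈-reflexive (cong ζ (-ₘ+ₘ a b)))

  unit-cancel : ∀ {a b u v} → b * a ≈ 1# → a * u ≈ a * v → u ≈ v
  unit-cancel {a} {b} {u} {v} ba≈1 au≈av = begin
    u              ≈⟨ *-identityˡ u ⟨
    1# * u         ≈⟨ *-congʳ ba≈1 ⟨
    (b * a) * u    ≈⟨ *-assoc b a u ⟩
    b * (a * u)    ≈⟨ *-congˡ au≈av ⟩
    b * (a * v)    ≈⟨ *-assoc b a v ⟨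
    (b * a) * v    ≈⟨ *-congʳ ba≈1 ⟩
    1# * v         ≈⟨ *-identityˡ v ⟩
    v ∎

  unit-zero : ∀ {a b u} → b * a ≈ 1# → a * u ≈ 0# → u ≈ 0#
  unit-zero ba≈1 au≈0 = unit-cancel ba≈1 (≈-trans au≈0 (≈-sym (zeroʳ _)))

  nonzero-unit : ∀ {a} → ¬ (a ≈ 0#) → ∃ λ b → b * a ≈ 1#
  nonzero-unit {a} a≉0 with IsField.inverse isField a a≉0
  ... | b , ab≈1 = b , ≈-trans (*-comm b a) ab≈1

  ζ-unit : ∀ a → ζ (zeroₘ -ₘ a) * ζ a ≈ 1#
  ζ-unit a = ≈-trans (ζ-sub zeroₘ a) ζ-zero

  ζ-cancel : ∀ a {u v} → ζ a * u ≈ ζ a * v → u ≈ v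
  ζ-cancel a = unit-cancel (ζ-unit a)

  ζ-cancel-zero : ∀ a {u} → ζ a * u ≈ 0# → u ≈ 0#
  ζ-cancel-zero a = unit-zero (ζ-unit a)

  ζ-distinct< : ∀ (a b : Fin m) → toℕ a ℕ.< toℕ b → ¬ (ζ a ≈ ζ b)
  ζ-distinct< a b a<b ζa≈ζb = proj₂ prim d 0<d d<m ω^d≈1
    where
    d : ℕ
    d = toℕ b ∸ toℕ a
    0<d : 0 ℕ.< d
    0<d = ℕP.m<n⇒0<n∸m a<b
    d<m : d ℕ.< m
    d<m = ℕP.≤-<-trans (ℕP.m∸n≤m (toℕ b) (toℕ a)) (FinP.toℕ<n b)
    ω^d≈1 : pow F ω d ≈ 1#
    ω^d≈1 = ≈-trans (≈-reflexive (pow≡^ ω d)) (≈-sym (ζ-cancel a (begin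
      ζ a * 1#            ≈⟨ *-identityʳ _ ⟩
      ζ a                 ≈⟨ ζa≈ζb ⟩
      ζ b                 ≡⟨ cong (ω ^_) (ℕP.m+[n∸m]≡n (ℕP.<⇒≤ a<b)) ⟨
      ω ^ (toℕ a ℕ.+ d)   ≈⟨ ^-homo-* ω (toℕ a) d ⟩
      ζ a * ω ^ d ∎)))

  ζ-injective : ∀ {a b} → ζ a ≈ ζ b → a ≡ b
  ζ-injective {a} {b} ζa≈ζb with ℕP.<-cmp (toℕ a) (toℕ b)
  ... | tri< a<b _ _ = ⊥-elim (ζ-distinct< a b a<b ζa≈ζb)
  ... | tri≈ _ a≡b _ = FinP.toℕ-injective a≡b
  ... | tri> _ _ b<a = ⊥-elim (ζ-distinct< b a b<a (≈-sym ζa≈ζb))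

  ν : ℕ → Carrier
  ν k = k ×ₙ 1#

  ν-^ : ∀ a k → ν (a ℕ.^ k) ≈ ν a ^ k
  ν-^ a zero    = +-identityʳ 1#
  ν-^ a (suc k) = ≈-trans (×1-homo-* a (a ℕ.^ k)) (*-congˡ (ν-^ a k))

  ν-suc≉0 : ∀ k → ¬ (ν (suc k) ≈ 0#)
  ν-suc≉0 k = charZero k ∘ ≈-trans (≈-reflexive (natF≡× (suc k)))

  ν-distinct< : ∀ {A B} → A ℕ.< B → ¬ (ν A ≈ ν B)
  ν-distinct< {A} {B} A<B νA≈νB = ν-suc≉0 D (identityʳ-unique (ν A) (ν (suc D)) (begin
    ν A + ν (suc D)    ≈⟨ ×-homo-+ 1# A (suc D) ⟨
    ν (A ℕ.+ suc D)    ≡⟨ cong ν B≡ ⟨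
    ν B                ≈⟨ νA≈νB ⟨
    ν A ∎))
    where
    D : ℕ
    D = B ∸ suc A
    B≡ : B ≡ A ℕ.+ suc D
    B≡ = ≡.sym (≡.trans (ℕP.+-suc A D) (ℕP.m+[n∸m]≡n A<B))

  ν-injective : ∀ {A B} → ν A ≈ ν B → A ≡ B
  ν-injective {A} {B} νA≈νB with ℕP.<-cmp A B
  ... | tri< A<B _ _ = ⊥-elim (ν-distinct< A<B νA≈νB)
  ... | tri≈ _ A≡B _ = A≡B
  ... | tri> _ _ B<A = ⊥-elim (ν-distinct< B<A (≈-sym νA≈νB))

  ^m-injective : ∀ {A B} → A ℕ.^ m ≡ B ℕ.^ m → A ≡ B
  ^m-injective {A} {B} eq with ℕP.<-cmp A B
  ... | tri< A<B _ _ = ⊥-elim (ℕP.<⇒≢ (ℕP.^-monoˡ-< m A<B) eq)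
  ... | tri≈ _ A≡B _ = A≡B
  ... | tri> _ _ B<A = ⊥-elim (ℕP.<⇒≢ (ℕP.^-monoˡ-< m B<A) (≡.sym eq))

  -- the value ζ a · (q+1) determines both q and a: its m-th power is
  -- (q+1)^m, and then the nonzero numeral q+1 can be cancelled
  separation : ∀ a b q q' → ζ a * ν (suc q) ≈ ζ b * ν (suc q') → q ≡ q' × a ≡ b
  separation a b q q' eq = q≡q' , ζ-injective (unit-cancel inv ζa≈ζb)
    where
    ζ^m : ∀ x → ζ x ^ m ≈ 1#
    ζ^m x = ≈-trans (^-assocʳ ω (toℕ x) m) (ω^[q*m]≈1 (toℕ x))
    power : ∀ x k → (ζ x * ν (suc k)) ^ m ≈ ν (suc k ℕ.^ m)
    power x k = begin
      (ζ x * ν (suc k)) ^ m          ≈⟨ ^-distrib-* (ζ x) (ν (suc k)) m ⟩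
      ζ x ^ m * ν (suc k) ^ m        ≈⟨ *-congʳ (ζ^m x) ⟩
      1# * ν (suc k) ^ m             ≈⟨ *-identityˡ _ ⟩
      ν (suc k) ^ m                  ≈⟨ ν-^ (suc k) m ⟨
      ν (suc k ℕ.^ m) ∎
    q≡q' : q ≡ q'
    q≡q' = ℕP.suc-injective (^m-injective (ν-injective
             (≈-trans (≈-sym (power a q)) (≈-trans (^-congˡ m eq) (power b q')))))
    inv : proj₁ (nonzero-unit (ν-suc≉0 q)) * ν (suc q) ≈ 1#
    inv = proj₂ (nonzero-unit (ν-suc≉0 q))
    ζa≈ζb : ν (suc q) * ζ a ≈ ν (suc q) * ζ b
    ζa≈ζb = begin
      ν (suc q) * ζ a     ≈⟨ *-comm _ _ ⟩
      ζ a * ν (suc q)     ≈⟨ eq ⟩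
      ζ b * ν (suc q')    ≡⟨ cong (λ k → ζ b * ν (suc k)) q≡q' ⟨
      ζ b * ν (suc q)     ≈⟨ *-comm _ _ ⟩
      ν (suc q) * ζ b ∎

  distinct-multipliers : ∀ a b {u} → ζ a * u ≈ ζ b * u → a ≢ b → u ≈ 0#
  distinct-multipliers a b {u} eq a≢b = unit-zero (proj₂ (nonzero-unit difference≉0)) (begin
    (ζ a - ζ b) * u          ≈⟨ distribʳ u (ζ a) (- ζ b) ⟩
    ζ a * u + (- ζ b) * u    ≈⟨ +-congˡ (-‿distribˡ-* (ζ b) u) ⟨
    ζ a * u - ζ b * u        ≈⟨ x≈y⇒x∙y⁻¹≈ε eq ⟩
    0# ∎)
    where
    difference≉0 : ¬ (ζ a - ζ b ≈ 0#)
    difference≉0 d≈0 = a≢b (ζ-injective (x∙y⁻¹≈ε⇒x≈y (ζ a) (ζ b) d≈0))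

  ≈-⇔ : ∀ {u u' v v'} → u ≈ u' → v ≈ v' → (u ≈ v) ⇔ (u' ≈ v')
  ≈-⇔ u≈u' v≈v' = mk⇔ (λ u≈v → ≈-trans (≈-sym u≈u') (≈-trans u≈v v≈v'))
                      (λ u'≈v' → ≈-trans u≈u' (≈-trans u'≈v' (≈-sym v≈v')))

  ≈-⇔-sym : ∀ {u v} → (u ≈ v) ⇔ (v ≈ u)
  ≈-⇔-sym = mk⇔ ≈-sym ≈-sym

  ζ-scaled-zero : ∀ a {u v} → u ≈ ζ a * v → (u ≈ 0#) ⇔ (v ≈ 0#)
  ζ-scaled-zero a {u} {v} u≈ζv = mk⇔
    (λ u≈0 → ζ-cancel-zero a (≈-trans (≈-sym u≈ζv) u≈0))
    (λ v≈0 → ≈-trans u≈ζv (≈-trans (*-congˡ v≈0) (zeroʳ (ζ a))))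

  ζ-solve : ∀ a d {x y} → (ζ a * x ≈ ζ d * y) ⇔ (y ≈ ζ (a -ₘ d) * x)
  ζ-solve a d {x} {y} = mk⇔
    (λ eq → ζ-cancel d (begin
      ζ d * y                  ≈⟨ eq ⟨
      ζ a * x                  ≈⟨ *-congʳ (ζ-sub a d) ⟨
      (ζ (a -ₘ d) * ζ d) * x   ≈⟨ *-congʳ (*-comm _ _) ⟩
      (ζ d * ζ (a -ₘ d)) * x   ≈⟨ *-assoc _ _ _ ⟩
      ζ d * (ζ (a -ₘ d) * x)   ∎))
    (λ eq → begin
      ζ a * x                  ≈⟨ *-congʳ (ζ-sub a d) ⟨
      (ζ (a -ₘ d) * ζ d) * x   ≈⟨ *-congʳ (*-comm _ _) ⟩
      (ζ d * ζ (a -ₘ d)) * x   ≈⟨ *-assoc _ _ _ ⟩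
      ζ d * (ζ (a -ₘ d) * x)   ≈⟨ *-congˡ eq ⟨
      ζ d * y                  ∎)

  ζ-distinct-zero : ∀ {a d} x → a ≢ d → (ζ a * x ≈ ζ d * x) ⇔ (x ≈ 0#)
  ζ-distinct-zero {a} {d} x a≢d = mk⇔
    (λ eq → distinct-multipliers a d eq a≢d)
    (λ x≈0 → ≈-trans (*-congˡ x≈0) (≈-trans (zeroʳ _) (≈-trans (≈-sym (zeroʳ _)) (*-congˡ (≈-sym x≈0)))))

  zero-left : ∀ l {u v} → u ≈ 0# → (u ≈ ζ l * v) ⇔ (v ≈ 0#)
  zero-left l u≈0 = mk⇔
    (λ eq → Equivalence.to (ζ-scaled-zero l ≈-refl) (≈-trans (≈-sym eq) u≈0))
    (λ v≈0 → ≈-trans u≈0 (≈-sym (Equivalence.from (ζ-scaled-zero l ≈-refl) v≈0)))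

  zero-right : ∀ l {u v} → v ≈ 0# → (u ≈ ζ l * v) ⇔ (u ≈ 0#)
  zero-right l v≈0 = ≈-⇔ ≈-refl (Equivalence.from (ζ-scaled-zero l ≈-refl) v≈0)

  ζ-invert : ∀ b {y z} → y ≈ ζ (zeroₘ -ₘ b) * z → z ≈ ζ b * y
  ζ-invert b {y} {z} eq = ≈-trans (≈-sym (≈-trans (*-congʳ ζ-zero) (*-identityˡ z))) (Equivalence.from (ζ-solve zeroₘ b) eq)

  common-ratio : ∀ a b {x y z} → x ≈ ζ (a -ₘ b) * z → y ≈ ζ (zeroₘ -ₘ b) * z → x ≈ ζ a * y
  common-ratio a b {x} {y} {z} x≈ y≈ = begin
    x                        ≈⟨ x≈ ⟩
    ζ (a -ₘ b) * z           ≈⟨ *-congˡ (ζ-invert b y≈) ⟩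
    ζ (a -ₘ b) * (ζ b * y)   ≈⟨ *-assoc _ _ _ ⟨
    (ζ (a -ₘ b) * ζ b) * y   ≈⟨ *-congʳ (ζ-sub a b) ⟩
    ζ a * y                  ∎

module FlatsOf {c ℓ : Level} (F : CommutativeRing c ℓ) (isField : IsField F) (charZero : CharZero F)
               {m : ℕ} .{{_ : NonZero m}} (ω : CommutativeRing.Carrier F) (prim : PrimitiveRoot F m ω)
               (N : ℕ) where
  open CommutativeRing F renaming (refl to ≈-refl; sym to ≈-sym; trans to ≈-trans; reflexive to ≈-reflexive)
  open import Relation.Binary.Reasoning.Setoid setoid
  open RootsOfUnity F isField charZero ω prim
  open Merges {N} {m}
  open Labels {m}
  open Shape {N} {m}

  Coords : Set c
  Coords = Fin N → Carrier

  Holds : Coords → Entry → Carrier → Set ℓ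
  Holds t nothing        u = u ≈ 0#
  Holds t (just (r , a)) u = u ≈ ζ a * t r

  _∈Flat_ : Coords → Raw N m → Set ℓ
  t ∈Flat f = ∀ i → Holds t (lookup f i) (t i)

  holds-at : ∀ f {t} → t ∈Flat f → ∀ {i v} → lookup f i ≡ v → Holds t v (t i)
  holds-at f {t} t∈f {i} e = subst (λ v → Holds t v (t i)) e (t∈f i)

  ∈Flat-resp : ∀ f {t t'} → t ∈Flat f → (∀ k → t k ≈ t' k) → t' ∈Flat f
  ∈Flat-resp f {t} {t'} t∈f t≈t' i = transport (lookup f i) (t∈f i)
    where
    transport : ∀ v → Holds t v (t i) → Holds t' v (t' i)
    transport nothing        h = ≈-trans (≈-sym (t≈t' i)) h
    transport (just (r , a)) h = ≈-trans (≈-sym (t≈t' i)) (≈-trans h (*-congˡ (t≈t' r)))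

  cover-flat : ∀ {f g} → Cover f g → ∀ t → t ∈Flat g → t ∈Flat f
  cover-flat (coverZero f r mr) t t∈g i
    with lookup f i | lookup (mergeZero f r) i | mz-view f r i | t∈g i
  ... | _ | _ | zero-block      | h = h
  ... | _ | _ | untouched _ _ _ | h = h
  ... | _ | _ | absorbed a      | h = begin
    t i        ≈⟨ h ⟩
    0#         ≈⟨ zeroʳ _ ⟨
    ζ a * 0#   ≈⟨ *-congˡ (holds-at (mergeZero f r) t∈g (mz-absorbs f r mr)) ⟨
    ζ a * t r  ∎
  cover-flat (coverBlocks f r s l mr ms r<s) t t∈g i
    with lookup f i | lookup (mergeBlocks f r s l) i | mb-view f r s l i | t∈g i
  ... | _ | _ | zero-block      | h = h
  ... | _ | _ | untouched _ _ _ | h = h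
  ... | _ | _ | moved a         | h = begin
    t i                             ≈⟨ h ⟩
    ζ (a +ₘ l) * t r                ≈⟨ *-congʳ (ζ-hom a l) ⟩
    (ζ a * ζ l) * t r               ≈⟨ *-assoc _ _ _ ⟩
    ζ a * (ζ l * t r)               ≈⟨ *-congˡ (*-congʳ (ζ-zero+ l)) ⟨
    ζ a * (ζ (zeroₘ +ₘ l) * t r)    ≈⟨ *-congˡ (holds-at (mergeBlocks f r s l) t∈g (mb-moves f r s l ms)) ⟨
    ζ a * t s ∎

  ≤D⇒⊇ : ∀ {f g} → f ≤D g → ∀ t → t ∈Flat g → t ∈Flat f
  ≤D⇒⊇ ε        t t∈g = t∈g
  ≤D⇒⊇ (c ◅ cs) t t∈g = cover-flat c t (≤D⇒⊇ cs t t∈g)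

  mz-flat-intro : ∀ f r t → t ∈Flat f → t r ≈ 0# → t ∈Flat mergeZero f r
  mz-flat-intro f r t t∈f tr≈0 i
    with lookup f i | lookup (mergeZero f r) i | mz-view f r i | t∈f i
  ... | _ | _ | zero-block      | h = h
  ... | _ | _ | untouched _ _ _ | h = h
  ... | _ | _ | absorbed a      | h = ≈-trans h (≈-trans (*-congˡ tr≈0) (zeroʳ (ζ a)))

  mb-flat-intro : ∀ f r s c t → t ∈Flat f → t s ≈ ζ c * t r → t ∈Flat mergeBlocks f r s c
  mb-flat-intro f r s c t t∈f ts≈ i
    with lookup f i | lookup (mergeBlocks f r s c) i | mb-view f r s c i | t∈f i
  ... | _ | _ | zero-block      | h = h
  ... | _ | _ | untouched _ _ _ | h = h
  ... | _ | _ | moved a         | h = begin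
    t i                  ≈⟨ h ⟩
    ζ a * t s            ≈⟨ *-congˡ ts≈ ⟩
    ζ a * (ζ c * t r)    ≈⟨ *-assoc _ _ _ ⟨
    (ζ a * ζ c) * t r    ≈⟨ *-congʳ (ζ-hom a c) ⟨
    ζ (a +ₘ c) * t r     ∎

  Cut : Raw N m → (Coords → Set ℓ) → Set (c ⊔ ℓ)
  Cut f E = Σ (Raw N m) λ g → Valid g × Shaped g × (∀ t → t ∈Flat g ⇔ (t ∈Flat f × E t))

  cut-trivial : ∀ f {E} → Valid f → Shaped f → (∀ t → t ∈Flat f → E t) → Cut f E
  cut-trivial f V S holds = f , V , S , λ t → mk⇔ (λ t∈f → t∈f , holds t t∈f) proj₁

  cut-equiv : ∀ f {E E'} → (∀ t → t ∈Flat f → E t ⇔ E' t) → Cut f E' → Cut f E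
  cut-equiv f E⇔E' (g , V , S , flat-g) = g , V , S , λ t → mk⇔
    (λ t∈g → let (t∈f , e') = Equivalence.to (flat-g t) t∈g in t∈f , Equivalence.from (E⇔E' t t∈f) e')
    (λ (t∈f , e) → Equivalence.from (flat-g t) (t∈f , Equivalence.to (E⇔E' t t∈f) e))

  cut-min-zero : ∀ f r → Valid f → Shaped f → IsBlockMin f r → JoinsZero f r →
                 Cut f (λ t → t r ≈ 0#)
  cut-min-zero f r V S mr joins =
    g , mz-valid f r V , mz-shaped f r V S mr joins , λ t → mk⇔
      (λ t∈g → cover-flat (coverZero f r mr) t t∈g , holds-at g t∈g (mz-absorbs f r mr))
      (λ (t∈f , tr≈0) → mz-flat-intro f r t t∈f tr≈0)
    where
    g : Raw N m
    g = mergeZero f r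

  cut-min-ratio : ∀ f r s → Valid f → Shaped f → IsBlockMin f r → IsBlockMin f s → r Fin.< s →
                  Linked f r s → ∀ c → Cut f (λ t → t s ≈ ζ c * t r)
  cut-min-ratio f r s V S mr ms r<s linked c =
    g , mb-valid f r s c V mr r<s , mb-shaped f r s c V S r<s linked , λ t → mk⇔
      (λ t∈g → cover-flat (coverBlocks f r s c mr ms r<s) t t∈g ,
               ≈-trans (holds-at g t∈g (mb-moves f r s c ms)) (*-congʳ (ζ-zero+ c)))
      (λ (t∈f , ts≈) → mb-flat-intro f r s c t t∈f ts≈)
    where
    g : Raw N m
    g = mergeBlocks f r s c

  cut-zero : ∀ f k → Valid f → Shaped f → OddElt k → Cut f (λ t → t k ≈ 0#)
  cut-zero f k V S ok with lookup f k in fk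
  ... | nothing      = cut-trivial f V S (λ t t∈f → holds-at f t∈f fk)
  ... | just (r , a) = cut-equiv f (λ t t∈f → ζ-scaled-zero a (holds-at f t∈f fk))
                                 (cut-min-zero f r V S (proj₂ (V k r a fk)) (k , (a , fk) , inj₁ ok))

  cut-ratio : ∀ f k k' → Valid f → Shaped f → OddElt k → EvenElt k' → k Fin.< k' →
              ∀ l → Cut f (λ t → t k ≈ ζ l * t k')
  cut-ratio f k k' V S ok ek' k<k' l with lookup f k in fk | lookup f k' in fk'
  ... | nothing | nothing = cut-trivial f V S λ t t∈f →
    ≈-trans (holds-at f t∈f fk) (≈-sym (Equivalence.from (ζ-scaled-zero l ≈-refl) (holds-at f t∈f fk')))
  ... | nothing | just (s , b) =
    cut-equiv f (λ t t∈f → ⇔-trans (zero-left l (holds-at f t∈f fk)) (ζ-scaled-zero b (holds-at f t∈f fk')))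
              (cut-min-zero f s V S (proj₂ (V k' s b fk')) (k' , (b , fk') , inj₂ (k , ok , k<k' , fk)))
  ... | just (r , a) | nothing =
    cut-equiv f (λ t t∈f → ⇔-trans (zero-right l (holds-at f t∈f fk')) (ζ-scaled-zero a (holds-at f t∈f fk)))
              (cut-min-zero f r V S (proj₂ (V k r a fk)) (k , (a , fk) , inj₁ ok))
  ... | just (r , a) | just (s , b) = cut-equiv-min (FinP.<-cmp r s)
    where
    mr : IsBlockMin f r
    mr = proj₂ (V k r a fk)
    ms : IsBlockMin f s
    ms = proj₂ (V k' s b fk')
    d : Fin m
    d = l +ₘ b
    on-minima : ∀ t → t ∈Flat f → (t k ≈ ζ l * t k') ⇔ (ζ a * t r ≈ ζ d * t s)
    on-minima t t∈f = ≈-⇔ (holds-at f t∈f fk) (begin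
      ζ l * t k'            ≈⟨ *-congˡ (holds-at f t∈f fk') ⟩
      ζ l * (ζ b * t s)     ≈⟨ *-assoc _ _ _ ⟨
      (ζ l * ζ b) * t s     ≈⟨ *-congʳ (ζ-hom l b) ⟨
      ζ d * t s             ∎)
    cut-equiv-min : Tri (r Fin.< s) (r ≡ s) (s Fin.< r) → Cut f (λ t → t k ≈ ζ l * t k')
    cut-equiv-min (tri≈ _ refl _) with a FinP.≟ d
    ... | yes refl = cut-trivial f V S (λ t t∈f → Equivalence.from (on-minima t t∈f) ≈-refl)
    ... | no a≢d   = cut-equiv f (λ t t∈f → ⇔-trans (on-minima t t∈f) (ζ-distinct-zero (t r) a≢d))
                               (cut-min-zero f r V S mr (k , (a , fk) , inj₁ ok))
    cut-equiv-min (tri< r<s _ _) =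
      cut-equiv f (λ t t∈f → ⇔-trans (on-minima t t∈f) (ζ-solve a d))
                (cut-min-ratio f r s V S mr ms r<s (k , k' , ok , ek' , k<k' , inj₁ ((a , fk) , (b , fk'))) (a -ₘ d))
    cut-equiv-min (tri> _ _ s<r) =
      cut-equiv f (λ t t∈f → ⇔-trans (on-minima t t∈f) (⇔-trans (≈-⇔-sym) (ζ-solve d a)))
                (cut-min-ratio f s r V S ms mr s<r (k , k' , ok , ek' , k<k' , inj₂ ((a , fk) , (b , fk'))) (d -ₘ a))

  -- The generic point of f': the block of r with label a gets the value
  -- ω^a (r+1).  It lies in the flat of f' and satisfies no other relations.
  -- the numeral r+1 attached to the block of r
  ν′ : Fin N → Carrier
  ν′ r = ν (ℕ.suc (toℕ r))

  genericValue : Entry → Carrier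
  genericValue nothing        = 0#
  genericValue (just (r , a)) = ζ a * ν′ r

  generic : Raw N m → Coords
  generic f' i = genericValue (lookup f' i)

  genericValue≉0 : ∀ b q → ¬ (ζ b * ν′ q ≈ 0#)
  genericValue≉0 b q = ν-suc≉0 (toℕ q) ∘ ζ-cancel-zero b

  generic-∈ : ∀ f' → Valid f' → generic f' ∈Flat f'
  generic-∈ f' V' i with lookup f' i in f'i
  ... | nothing      = ≈-refl
  ... | just (r , a) = *-congˡ (begin
    ν′ r                            ≈⟨ *-identityˡ _ ⟨
    1# * ν′ r                       ≈⟨ *-congʳ ζ-zero ⟨
    genericValue (just (r , zeroₘ)) ≡⟨ cong genericValue (proj₂ (V' i r a f'i)) ⟨
    generic f' r                    ∎)

  generic-refines : ∀ f f' (V' : Valid f') → generic f' ∈Flat f → Refinement.Refines f' V' f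
  generic-refines f f' V' g∈f i with lookup f i | g∈f i
  ... | nothing | h with lookup f' i
  ...   | nothing      = refl
  ...   | just (q , b) = ⊥-elim (genericValue≉0 b q h)
  generic-refines f f' V' g∈f i | just (s , a) | h with lookup f' i | lookup f' s
  ... | nothing      | nothing        = inj₁ (refl , refl)
  ... | nothing      | just (q' , b') = ⊥-elim (genericValue≉0 (a +ₘ b') q' (begin
    ζ (a +ₘ b') * ν′ q'      ≈⟨ *-congʳ (ζ-hom a b') ⟩
    (ζ a * ζ b') * ν′ q'     ≈⟨ *-assoc _ _ _ ⟩
    ζ a * (ζ b' * ν′ q')     ≈⟨ h ⟨
    0#                       ∎))
  ... | just (q , b) | nothing        = ⊥-elim (genericValue≉0 b q (≈-trans h (zeroʳ (ζ a))))
  ... | just (q , b) | just (q' , b') with separation b (a +ₘ b') (toℕ q) (toℕ q') (begin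
    ζ b * ν′ q               ≈⟨ h ⟩
    ζ a * (ζ b' * ν′ q')     ≈⟨ *-assoc _ _ _ ⟨
    (ζ a * ζ b') * ν′ q'     ≈⟨ *-congʳ (ζ-hom a b') ⟨
    ζ (a +ₘ b') * ν′ q'      ∎)
  ...   | q≡q' , b≡ with FinP.toℕ-injective q≡q'
  ...     | refl = inj₂ (q , b , b' , refl , refl , b≡)

  ⊇⇒≤D : ∀ f f' → Valid f → Valid f' → (∀ t → t ∈Flat f' → t ∈Flat f) → f ≤D f'
  ⊇⇒≤D f f' V V' f'⊆f = Refinement.refines⇒≤D f' V' f V (generic-refines f f' V' (f'⊆f (generic f') (generic-∈ f' V')))

-- Elements of [2n-1] encode the coordinates z_i = x_i - y_i (the odd
-- element 2i+1, i < n) and x_{j+1} (the even element 2j+2, j < n-1).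
module Encoding (n' : ℕ) where
  n N : ℕ
  n = suc n'
  N = 2 ℕ.* n ∸ 1

  N≡ : N ≡ suc (2 ℕ.* n')
  N≡ = cong (_∸ 1) (ℕP.*-suc 2 n')

  -- the odd element 2i+1 and the even element 2j+2 (as Fin N: 2i and 2j+1)
  oddOf : Fin n → Fin N
  oddOf i = fromℕ< (subst (2 ℕ.* toℕ i ℕ.<_) (≡.sym N≡) (s≤s (ℕP.*-monoʳ-≤ 2 (ℕP.≤-pred (FinP.toℕ<n i)))))

  evenOf : Fin n' → Fin N
  evenOf j = fromℕ< (subst (suc (2 ℕ.* toℕ j) ℕ.<_) (≡.sym N≡) (s≤s (ℕP.*-monoʳ-< 2 (FinP.toℕ<n j))))

  toℕ-oddOf : ∀ i → toℕ (oddOf i) ≡ 2 ℕ.* toℕ i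
  toℕ-oddOf i = FinP.toℕ-fromℕ< _

  toℕ-evenOf : ∀ j → toℕ (evenOf j) ≡ suc (2 ℕ.* toℕ j)
  toℕ-evenOf j = FinP.toℕ-fromℕ< _

  oddOf-odd : ∀ i → OddElt (oddOf i)
  oddOf-odd i = ≡.trans (cong (λ z → suc z DM.% 2) (≡.trans (toℕ-oddOf i) (ℕP.*-comm 2 (toℕ i))))
                        (DM.[m+kn]%n≡m%n 1 (toℕ i) 2)

  evenOf-even : ∀ j → EvenElt (evenOf j)
  evenOf-even j = ≡.trans (cong (λ z → suc z DM.% 2) (≡.trans (toℕ-evenOf j) (cong suc (ℕP.*-comm 2 (toℕ j)))))
                          (DM.[m+kn]%n≡m%n 2 (toℕ j) 2)

  oddOf-injective : ∀ {i i'} → oddOf i ≡ oddOf i' → i ≡ i'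
  oddOf-injective {i} {i'} eq = FinP.toℕ-injective (ℕP.*-cancelˡ-≡ (toℕ i) (toℕ i') 2
    (≡.trans (≡.sym (toℕ-oddOf i)) (≡.trans (cong toℕ eq) (toℕ-oddOf i'))))

  evenOf-injective : ∀ {j j'} → evenOf j ≡ evenOf j' → j ≡ j'
  evenOf-injective {j} {j'} eq = FinP.toℕ-injective (ℕP.*-cancelˡ-≡ (toℕ j) (toℕ j') 2
    (ℕP.suc-injective (≡.trans (≡.sym (toℕ-evenOf j)) (≡.trans (cong toℕ eq) (toℕ-evenOf j')))))

  oddOf<evenOf : ∀ i j → toℕ i ℕ.≤ toℕ j → oddOf i Fin.< evenOf j
  oddOf<evenOf i j i≤j = subst₂ ℕ._<_ (≡.sym (toℕ-oddOf i)) (≡.sym (toℕ-evenOf j)) (s≤s (ℕP.*-monoʳ-≤ 2 i≤j))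

  oddOf<evenOf⁻ : ∀ i j → oddOf i Fin.< evenOf j → toℕ i ℕ.≤ toℕ j
  oddOf<evenOf⁻ i j lt = ℕP.*-cancelˡ-≤ 2 (ℕP.≤-pred (subst₂ ℕ._<_ (toℕ-oddOf i) (toℕ-evenOf j) lt))

  data Kind (k : Fin N) : Set where
    odd  : ∀ i → k ≡ oddOf i → Kind k
    even : ∀ j → k ≡ evenOf j → Kind k

  private
    halve : ∀ x → (∃ λ q → x ≡ 2 ℕ.* q) ⊎ (∃ λ q → x ≡ suc (2 ℕ.* q))
    halve zero = inj₁ (0 , refl)
    halve (suc x) with halve x
    ... | inj₁ (q , x≡) = inj₂ (q , cong suc x≡)
    ... | inj₂ (q , x≡) = inj₁ (suc q , ≡.trans (cong suc x≡) (≡.sym (ℕP.*-suc 2 q)))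

  kind : ∀ k → Kind k
  kind k with halve (toℕ k)
  ... | inj₁ (q , k≡) = odd i (FinP.toℕ-injective (≡.sym (≡.trans (toℕ-oddOf i) (≡.trans (cong (2 ℕ.*_) (FinP.toℕ-fromℕ< q<n)) (≡.sym k≡)))))
    where
    q<n : q ℕ.< n
    q<n = s≤s (ℕP.*-cancelˡ-≤ 2 (ℕP.≤-pred (subst₂ ℕ._<_ k≡ N≡ (FinP.toℕ<n k))))
    i : Fin n
    i = fromℕ< q<n
  ... | inj₂ (q , k≡) = even j (FinP.toℕ-injective (≡.sym (≡.trans (toℕ-evenOf j) (≡.trans (cong (λ z → suc (2 ℕ.* z)) (FinP.toℕ-fromℕ< q<n')) (≡.sym k≡)))))
    where
    q<n' : q ℕ.< n'
    q<n' = ℕP.*-cancelˡ-< 2 _ _ (ℕP.≤-pred (subst₂ ℕ._<_ k≡ N≡ (FinP.toℕ<n k)))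
    j : Fin n'
    j = fromℕ< q<n'

  oddOf≢evenOf : ∀ i j → oddOf i ≢ evenOf j
  oddOf≢evenOf i j = odd≢even (oddOf i) (evenOf j) (oddOf-odd i) (evenOf-even j)

  odd⇒oddOf : ∀ k → OddElt k → ∃ λ i → k ≡ oddOf i
  odd⇒oddOf k ok with kind k
  ... | odd i k≡  = i , k≡
  ... | even j k≡ = ⊥-elim (odd≢even k (evenOf j) ok (evenOf-even j) k≡)

  even⇒evenOf : ∀ k → EvenElt k → ∃ λ j → k ≡ evenOf j
  even⇒evenOf k ek with kind k
  ... | even j k≡ = j , k≡
  ... | odd i k≡  = ⊥-elim (odd≢even (oddOf i) k (oddOf-odd i) ek (≡.sym k≡))

module Arrangement {c ℓ : Level} (F : CommutativeRing c ℓ) (isField : IsField F) (charZero : CharZero F)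
                   {m : ℕ} .{{_ : NonZero m}} (ω : CommutativeRing.Carrier F) (prim : PrimitiveRoot F m ω)
                   (n' : ℕ) where
  open CommutativeRing F renaming (refl to ≈-refl; sym to ≈-sym; trans to ≈-trans; reflexive to ≈-reflexive)
  open import Relation.Binary.Reasoning.Setoid setoid
  open import Algebra.Properties.AbelianGroup +-abelianGroup using (⁻¹-anti-homo‿-; xyx⁻¹≈y)
  open import Algebra.Properties.Group (CommutativeRing.+-group F) using (x∙y⁻¹≈ε⇒x≈y; x≈y⇒x∙y⁻¹≈ε)
  open RootsOfUnity F isField charZero ω prim
  open Encoding n'
  open FlatsOf F isField charZero ω prim N
  open Merges {N} {m}
  open Shape {N} {m}
  open Labels {m}

  Pt : Set c
  Pt = Point F ω n

  sub-sub : ∀ x u → x - (x - u) ≈ u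
  sub-sub x u = begin
    x - (x - u)     ≈⟨ +-congˡ (⁻¹-anti-homo‿- x u) ⟩
    x + (u - x)     ≈⟨ +-assoc x u (- x) ⟨
    x + u - x       ≈⟨ xyx⁻¹≈y x u ⟩
    u               ∎

  sub-swap : ∀ {x u y} → x - u ≈ y → x - y ≈ u
  sub-swap {x} {u} {y} eq = ≈-trans (+-congˡ (-‿cong (≈-sym eq))) (sub-sub x u)

  coords : Pt → Coords
  coords (x , y) k with kind k
  ... | odd i _  = x i - y i
  ... | even j _ = x (Fin.suc j)

  coords-odd : ∀ p i → coords p (oddOf i) ≈ proj₁ p i - proj₂ p i
  coords-odd (x , y) i with kind (oddOf i)
  ... | odd i' e  = ≈-reflexive (cong (λ z → x z - y z) (≡.sym (oddOf-injective e)))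
  ... | even j e  = ⊥-elim (oddOf≢evenOf i j e)

  coords-even : ∀ p j → coords p (evenOf j) ≈ proj₁ p (Fin.suc j)
  coords-even (x , y) j with kind (evenOf j)
  ... | odd i e   = ⊥-elim (oddOf≢evenOf i j (≡.sym e))
  ... | even j' e = ≈-reflexive (cong (λ z → x (Fin.suc z)) (≡.sym (evenOf-injective e)))

  point : Coords → Pt
  point t = x , (λ i → x i - t (oddOf i))
    where
    x : Fin n → Carrier
    x Fin.zero    = 0#
    x (Fin.suc j) = t (evenOf j)

  coords-point : ∀ t k → coords (point t) k ≈ t k
  coords-point t k with kind k
  ... | odd i refl  = sub-sub _ _
  ... | even j refl = ≈-refl

  on-diag : ∀ p i → _∈H_ F ω {n} {m} p (hypDiag i) ⇔ (coords p (oddOf i) ≈ 0#)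
  on-diag p i = mk⇔
    (λ on → ≈-trans (coords-odd p i) (x≈y⇒x∙y⁻¹≈ε on))
    (λ z≈0 → x∙y⁻¹≈ε⇒x≈y _ _ (≈-trans (≈-sym (coords-odd p i)) z≈0))

  on-diff : ∀ p i j q l → _∈H_ F ω p (hypDiff i (Fin.suc j) q l) ⇔ (coords p (oddOf i) ≈ ζ l * coords p (evenOf j))
  on-diff p i j q l = mk⇔
    (λ on → ≈-trans (coords-odd p i) (≈-trans (sub-swap on) (*-cong (≈-reflexive (pow≡^ ω (toℕ l))) (≈-sym (coords-even p j)))))
    (λ eq → sub-swap (≈-trans (≈-sym (coords-odd p i)) (≈-trans eq (*-cong (≈-reflexive (≡.sym (pow≡^ ω (toℕ l)))) (coords-even p j)))))

  diffs : Fin n → Fin n → Fin m → List (Hyp n m)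
  diffs i j l with toℕ i ℕP.<? toℕ j
  ... | yes i<j = hypDiff i j i<j l ∷ []
  ... | no  _   = []

  hypsAt : Fin n → List (Hyp n m)
  hypsAt i = hypDiag i ∷ concatMap (λ j → concatMap (diffs i j) (allFin m)) (allFin n)

  allHyps : List (Hyp n m)
  allHyps = concatMap hypsAt (allFin n)

  ∈-diffs : ∀ i j i<j l → hypDiff i j i<j l ∈ diffs i j l
  ∈-diffs i j i<j l with toℕ i ℕP.<? toℕ j
  ... | yes i<j′ = here (cong (λ p → hypDiff i j p l) (ℕP.<-irrelevant i<j i<j′))
  ... | no  i≮j  = ⊥-elim (i≮j i<j)

  ∈-allHyps : ∀ h → h ∈ allHyps
  ∈-allHyps (hypDiag i) = ∈-concatMap hypsAt i (∈-allFin i) (here refl)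
  ∈-allHyps (hypDiff i j i<j l) = ∈-concatMap hypsAt i (∈-allFin i) (there
    (∈-concatMap (λ j → concatMap (diffs i j) (allFin m)) j (∈-allFin j)
      (∈-concatMap (diffs i j) l (∈-allFin l) (∈-diffs i j i<j l))))

  -- The hyperplanes containing the flat of d, read off combinatorially:
  -- z_i = 0 when 2i+1 is in the zero block, and z_i = ω^l x_{j+1} when the
  -- entries of 2i+1 and 2j+2 are related by the label l.
  Related : Fin m → Entry → Entry → Set
  Related l nothing        nothing          = ⊤
  Related l (just (r , a)) (just (r' , b))  = r ≡ r' × a ≡ l +ₘ b
  Related l _              _                = ⊥

  related? : ∀ l u v → Dec (Related l u v)
  related? l nothing        nothing          = yes tt
  related? l nothing        (just _)         = no λ ()
  related? l (just _)       nothing          = no λ ()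
  related? l (just (r , a)) (just (r' , b))  = (r FinP.≟ r') ×-dec (a FinP.≟ (l +ₘ b))

  Contains : Raw N m → Hyp n m → Set
  Contains d (hypDiag i)                 = lookup d (oddOf i) ≡ nothing
  Contains d (hypDiff i Fin.zero ()  l)
  Contains d (hypDiff i (Fin.suc j) _ l) = Related l (lookup d (oddOf i)) (lookup d (evenOf j))

  contains? : ∀ d h → Dec (Contains d h)
  contains? d (hypDiag i)                 = lookup d (oddOf i) ≟ₑ nothing
  contains? d (hypDiff i Fin.zero () l)
  contains? d (hypDiff i (Fin.suc j) _ l) = related? l _ _

  φ₀ : Raw N m → List (Hyp n m)
  φ₀ d = filter (contains? d) allHyps

  related-holds : ∀ t {l u v} k k' → Related l u v → Holds t u (t k) → Holds t v (t k') → t k ≈ ζ l * t k'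
  related-holds t {l} {nothing}    {nothing}       k k' _ tk≈0 tk'≈0 =
    ≈-trans tk≈0 (≈-sym (Equivalence.from (ζ-scaled-zero l ≈-refl) tk'≈0))
  related-holds t {l} {just (r , _)} {just (_ , b)} k k' (refl , refl) tk≈ tk'≈ = begin
    t k                 ≈⟨ tk≈ ⟩
    ζ (l +ₘ b) * t r    ≈⟨ *-congʳ (ζ-hom l b) ⟩
    (ζ l * ζ b) * t r   ≈⟨ *-assoc _ _ _ ⟩
    ζ l * (ζ b * t r)   ≈⟨ *-congˡ tk'≈ ⟨
    ζ l * t k'          ∎

  flat⇒⋂ : ∀ d p → coords p ∈Flat d → _∈⋂_ F ω p (φ₀ d)
  flat⇒⋂ d p p∈d {h} h∈ = on {h} (proj₂ (∈-filter⁻ (contains? d) {xs = allHyps} h∈))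
    where
    on : ∀ {h} → Contains d h → _∈H_ F ω p h
    on {hypDiag i} c = Equivalence.from (on-diag p i) (holds-at d p∈d c)
    on {hypDiff i (Fin.suc j) q l} c =
      Equivalence.from (on-diff p i j q l) (related-holds (coords p) (oddOf i) (evenOf j) c (p∈d (oddOf i)) (p∈d (evenOf j)))

  -- For d in L^m_{2n-1}, a point on every hyperplane containing the flat
  -- of d lies on the flat: each defining equation of the flat follows from
  -- one or two such hyperplanes.
  module _ (d : Raw N m) (V : Valid d) (I : InL d) (p : Pt) (p∈ : _∈⋂_ F ω p (φ₀ d)) where
    private
      t : Coords
      t = coords p

    on : ∀ h → Contains d h → _∈H_ F ω p h
    on h c = p∈ (∈-filter⁺ (contains? d) (∈-allHyps h) c)

    zero-at : ∀ i → lookup d (oddOf i) ≡ nothing → t (oddOf i) ≈ 0#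
    zero-at i e = Equivalence.to (on-diag p i) (on (hypDiag i) e)

    ratio-at : ∀ i j l → oddOf i Fin.< evenOf j → Related l (lookup d (oddOf i)) (lookup d (evenOf j)) →
               t (oddOf i) ≈ ζ l * t (evenOf j)
    ratio-at i j l i<j rel = Equivalence.to (on-diff p i j q l) (on (hypDiff i (Fin.suc j) q l) rel)
      where
      q : i Fin.< Fin.suc j
      q = s≤s (oddOf<evenOf⁻ i j i<j)

    in-block-ratio : ∀ i j {r a b} → lookup d (oddOf i) ≡ just (r , a) → lookup d (evenOf j) ≡ just (r , b) →
                     oddOf i Fin.< evenOf j → t (oddOf i) ≈ ζ (a -ₘ b) * t (evenOf j)
    in-block-ratio i j {r} {a} {b} ei ej i<j =
      ratio-at i j (a -ₘ b) i<j (subst₂ (Related (a -ₘ b)) (≡.sym ei) (≡.sym ej) (refl , ≡.sym (-ₘ+ₘ a b)))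

    at-minimum : ∀ {k a} → lookup d k ≡ just (k , a) → t k ≈ ζ a * t k
    at-minimum {k} {a} e with ≡.trans (≡.sym e) (proj₂ (V k k a e))
    ... | refl = ≈-sym (≈-trans (*-congʳ ζ-zero) (*-identityˡ (t k)))

    -- 2i+1 in the nonsingleton block of r: both 2i+1 and r (odd) are
    -- related to the maximum of the block, which is even
    at-odd : ∀ i → Holds t (lookup d (oddOf i)) (t (oddOf i))
    at-odd i with lookup d (oddOf i) in e
    ... | nothing      = zero-at i e
    ... | just (r , a) with r FinP.≟ oddOf i | V (oddOf i) r a e
    ...   | yes refl | _ = at-minimum e
    ...   | no r≢k   | _ , mr with proj₂ I r mr (oddOf i , (a , e) , r≢k ∘ ≡.sym)
    ...     | r-odd , max-even with greatest (InBlock d r) (inBlock? d r) (oddOf i) (a , e)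
    ...       | M , (bM , eM) , M-max with even⇒evenOf M (max-even M (bM , eM) M-max) | odd⇒oddOf r r-odd
    ...         | j' , refl | i₀ , refl =
      common-ratio a bM (in-block-ratio i j' e eM (below-max (oddOf i) (oddOf-odd i) (a , e)))
                        (in-block-ratio i₀ j' mr eM (below-max (oddOf i₀) r-odd (zeroₘ , mr)))
      where
      below-max : ∀ x → OddElt x → InBlock d (oddOf i₀) x → x Fin.< evenOf j'
      below-max x ox x∈r = FinP.≤∧≢⇒< (M-max x x∈r) (odd≢even x (evenOf j') ox (evenOf-even j'))

    -- 2j+2 in the zero block: the least element of the zero block is odd;
    -- 2j+2 in the block of r ≠ 2j+2: r is odd and below 2j+2
    at-even : ∀ j → Holds t (lookup d (evenOf j)) (t (evenOf j))
    at-even j with lookup d (evenOf j) in e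
    ... | nothing with least (λ x → lookup d x ≡ nothing) (λ x → lookup d x ≟ₑ nothing) (evenOf j) e
    ...   | o , o∈0 , o≤k , none-below with odd⇒oddOf o (proj₁ I o o∈0 none-below)
    ...     | i₁ , refl = Equivalence.to (ζ-scaled-zero zeroₘ (ratio-at i₁ j zeroₘ o<k rel)) (zero-at i₁ o∈0)
      where
      o<k : oddOf i₁ Fin.< evenOf j
      o<k = FinP.≤∧≢⇒< o≤k (odd≢even (oddOf i₁) (evenOf j) (oddOf-odd i₁) (evenOf-even j))
      rel : Related zeroₘ (lookup d (oddOf i₁)) (lookup d (evenOf j))
      rel = subst₂ (Related zeroₘ) (≡.sym o∈0) (≡.sym e) tt
    at-even j | just (r , a) with r FinP.≟ evenOf j | V (evenOf j) r a e
    ...   | yes refl | _ = at-minimum e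
    ...   | no r≢k   | r≤k , mr with odd⇒oddOf r (proj₁ (proj₂ I r mr (evenOf j , (a , e) , r≢k ∘ ≡.sym)))
    ...     | i₀ , refl = ζ-invert a (in-block-ratio i₀ j mr e (FinP.≤∧≢⇒< r≤k r≢k))

    ⋂⇒flat : coords p ∈Flat d
    ⋂⇒flat k = by-kind (kind k)
      where
      by-kind : Kind k → Holds t (lookup d k) (t k)
      by-kind (odd i k≡)  = subst (λ z → Holds t (lookup d z) (t z)) (≡.sym k≡) (at-odd i)
      by-kind (even j k≡) = subst (λ z → Holds t (lookup d z) (t z)) (≡.sym k≡) (at-even j)

  -- Every intersection of hyperplanes is the flat of a valid shaped
  -- labeled partition, built by cutting with one hyperplane at a time.
  Realises : List (Hyp n m) → Set (c ⊔ ℓ)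
  Realises S = Σ (Raw N m) λ d → Valid d × Shaped d × (∀ p → _∈⋂_ F ω p S ⇔ coords p ∈Flat d)

  discrete-flat : ∀ t → t ∈Flat discrete
  discrete-flat t i = subst (λ v → Holds t v (t i)) (≡.sym (discrete-at i)) (≈-sym (≈-trans (*-congʳ ζ-zero) (*-identityˡ (t i))))

  extend : ∀ {S h E} → Realises S → (∀ p → _∈H_ F ω p h ⇔ E (coords p)) →
           (∀ d → Valid d → Shaped d → Cut d E) → Realises (h ∷ S)
  extend (d , V , Sh , S⇔d) h⇔E cut with cut d V Sh
  ... | g , Vg , Shg , g⇔ = g , Vg , Shg , λ p → mk⇔
    (λ p∈ → Equivalence.from (g⇔ (coords p)) (Equivalence.to (S⇔d p) (λ h∈ → p∈ (there h∈)) ,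
                                               Equivalence.to (h⇔E p) (p∈ (here refl))))
    (λ p∈g → let (p∈d , e) = Equivalence.to (g⇔ (coords p)) p∈g in
      λ { (here refl) → Equivalence.from (h⇔E p) e ; (there h∈) → Equivalence.from (S⇔d p) p∈d h∈ })

  realise : ∀ S → Realises S
  realise [] = discrete , discrete-valid , discrete-shaped , λ p → mk⇔ (λ _ → discrete-flat (coords p)) (λ _ ())
  realise (hypDiag i ∷ S) =
    extend (realise S) (λ p → on-diag p i) (λ d V Sh → cut-zero d (oddOf i) V Sh (oddOf-odd i))
  realise (hypDiff i (Fin.suc j) q l ∷ S) =
    extend (realise S) (λ p → on-diff p i j q l)
           (λ d V Sh → cut-ratio d (oddOf i) (evenOf j) V Sh (oddOf-odd i) (evenOf-even j) (oddOf<evenOf i j (ℕP.≤-pred q)) l)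

  φ : LDow n m → List (Hyp n m)
  φ (d , _) = φ₀ d

  every-flat : ∀ S → ∃ λ d → _≤L_ F ω S (φ d) × _≤L_ F ω (φ d) S
  every-flat S with realise S
  ... | d , V , Sh , S⇔d = (d , V , I) ,
        (λ p p∈ → Equivalence.from (S⇔d p) (⋂⇒flat d V I p (λ {h} → p∈ {h}))) ,
        (λ p p∈ → flat⇒⋂ d p (Equivalence.to (S⇔d p) (λ {h} → p∈ {h})))
    where
    I : InL d
    I = Shaped⇒InL d Sh

  order-iso : ∀ d d' → (proj₁ d ≤D proj₁ d') ⇔ _≤L_ F ω (φ d) (φ d')
  order-iso (f , V , I) (f' , V' , I') = mk⇔ order⇒inclusion inclusion⇒order
    where
    order⇒inclusion : f ≤D f' → _≤L_ F ω (φ₀ f) (φ₀ f')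
    order⇒inclusion f≤f' p p∈ = flat⇒⋂ f p (≤D⇒⊇ f≤f' (coords p) (⋂⇒flat f' V' I' p (λ {h} → p∈ {h})))
    inclusion⇒order : _≤L_ F ω (φ₀ f) (φ₀ f') → f ≤D f'
    inclusion⇒order φf≤φf' = ⊇⇒≤D f f' V V' flat⊇
      where
      flat⊇ : ∀ t → t ∈Flat f' → t ∈Flat f
      flat⊇ t t∈f' = ∈Flat-resp f (⋂⇒flat f V I p (φf≤φf' p (λ {h} → flat⇒⋂ f' p p∈f' {h}))) (coords-point t)
        where
        p : Pt
        p = point t
        p∈f' : coords p ∈Flat f'
        p∈f' = ∈Flat-resp f' t∈f' (λ k → ≈-sym (coords-point t k))

  lattice-iso : LatticeIso F ω n m
  lattice-iso = φ , every-flat , order-iso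

theorem4p2 : ∀ {c ℓ : Level} (F : CommutativeRing c ℓ) → IsField F → CharZero F →
    (n m : ℕ) → 1 ≤ n → .{{_ : NonZero m}} →
    (ω : CommutativeRing.Carrier F) → PrimitiveRoot F m ω →
    LatticeIso F ω n m
theorem4p2 F isField charZero zero     m ()
theorem4p2 F isField charZero (suc n') m _  ω prim = Arrangement.lattice-iso F isField charZero ω prim n'
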